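{- Let $G$ be an instance of well-structured MAP, and let $H$ be a spanning subgraph of $G$ that contains all zero-edges of $G$ and is simple, bridgeless and of minimum degree at least two. Let $\mathcal{A}$ be a small 2ec-block of $H$. If there is a 2ec-block $B\neq\mathcal{A}$ of $H$ with $\Gamma_G(V(\mathcal{A}))\subseteq V(B)$, then $B$ is large.
   Context: An instance of MAP is a loop-free, 2-edge connected multigraph $G$ with edge costs in $\{0,1\}$ whose cost-$0$ edges ("zero-edges") form a matching; cost-$1$ edges are unit-edges. A graph is 2-edge connected (2EC) if it has at least $2$ nodes and is connected after deleting any single edge. It is 2NC if it has at least $3$ nodes and is connected after deleting any single node. A 2-ECSS is a 2EC spanning subgraph, and $\mathrm{opt}(\cdot)$ is its minimum cost. $G/S$ identifies the nodes of $S$ into a node $\hat v$ and deletes the edges inside $S$. For a cut node $w$ of a 2EC graph $M$, a 2ec-$w$-block is the subgraph induced by $\{w\}\cup V(D)$ for a component $D$ of $M-w$. An attachment of a subgraph $C$ is a node of $C$ with a neighbour outside $V(C)$, and $\delta(S)$ is the set of edges with exactly one end in $S$. An instance of well-structured MAP is an instance of MAP with at least $12$ nodes that contains none of the following: a cut node; parallel edges; a zero-cost S2; a unit-cost S2; an S$\{3,4\}$; an R4; an R8. These are defined as follows. (1) A zero-cost S2 is a zero-edge $uv$ with $G-\{u,v\}$ disconnected. (2) A unit-cost S2 is a unit-edge $uv$ with $G-\{u,v\}$ disconnected such that $G/\{u,v\}$ has two distinct 2ec-$\hat v$-blocks, each with $\mathrm{opt}\ge3$ and each containing a zero-edge incident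 to $\hat v$. (3) An S$\{3,4\}$ is an induced 2NC subgraph $C$ with $|V(C)|\in\{3,4\}$ satisfying all of the following. It has a spanning cycle of cost $2$. The graph $G-V(C)$ is disconnected. The cut $\delta(V(C))$ has no zero-edge. The graph $G/V(C)$ has two distinct 2ec-$\hat v$-blocks, each with $\mathrm{opt}\ge3$. (4) An R4 is an induced subgraph $C$ on $4$ nodes, $V(C)\ne V(G)$, containing a 4-cycle of cost $2$ and two nonadjacent nodes each of degree $2$ in $G$. (5) An R8 is an induced subgraph $C$ on $8$ nodes, $V(C)\ne V(G)$, satisfying all of the following. It contains two node-disjoint 4-cycles $C_1,C_2$ of cost $2$. It has exactly two attachments $a_1\in V(C_1)$ and $a_2\in V(C_2)$. For $i=1,2$, both ends of the unique unit-edge of $C_i-a_i$ are adjacent to $V(C_{3-i})$. A 2ec-block of $H$ is a maximal connected subgraph of $H$ with at least two nodes and no bridges. For $H$ as in the claim, these are exactly the connected components of $H$. A 2ec-block is small if it has at most $2$ unit-edges, and large otherwise. $\Gamma_G(S)$ denotes the set of nodes outside $S$ adjacent in $G$ to some node of $S$. -}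

module Defs where

open import Data.Nat as ℕ using (ℕ; zero; suc; _+_; _≤_; _≥_)
open import Data.Bool using (Bool; true; false; if_then_else_; _∧_; _∨_; not)
open import Data.Fin as Fin using (Fin; toℕ; lower₁)
open import Data.Fin.Subset using (Subset; _∈_; _∉_; _⊆_; ⁅_⁆; _∪_; _∩_; ∣_∣)
open import Data.Vec using (Vec; []; _∷_; lookup; tabulate)
open import Data.Product using (Σ; ∃; ∃-syntax; _×_; _,_; proj₁; proj₂)
open import Data.Sum using (_⊎_)
open import Data.List using (List; map; allFin)
open import Data.Nat.ListAction using (sum)
open import Relation.Binary.PropositionalEquality using (_≡_; _≢_)
open import Relation.Nullary using (¬_; yes; no; Dec)
open import Relation.Nullary.Decidable using (⌊_⌋)

_=ᵇ_ : ∀ {n} → Fin n → Fin n → Bool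
x =ᵇ y = ⌊ x Fin.≟ y ⌋

sumSel : ∀ {m} → Subset m → (Fin m → ℕ) → ℕ
sumSel {zero}  []      f = 0
sumSel {suc m} (b ∷ s) f = (if b then f Fin.zero else 0) + sumSel s (λ i → f (Fin.suc i))

sumFin : ∀ k → (Fin k → ℕ) → ℕ
sumFin k f = sum (map f (allFin k))

-- cyclic successor on Fin k
next : ∀ {k} → Fin k → Fin k
next {suc k} i with k ℕ.≟ toℕ i
... | yes _ = Fin.zero
... | no p  = Fin.suc (lower₁ i p)

-- A graph consists of a node set V, an edge set E and an
-- endpoint map (edges in E are assumed to have their ends in V).

record Gr (n m : ℕ) : Set where
  constructor gr
  field
    V   : Subset n
    E   : Subset m
    end : Fin m → Fin n × Fin n
open Gr public

module _ {n m : ℕ} where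

  Joins : Gr n m → Fin m → Fin n → Fin n → Set
  Joins M e x y = end M e ≡ (x , y) ⊎ end M e ≡ (y , x)

  IsEnd : Gr n m → Fin n → Fin m → Set
  IsEnd M x e = proj₁ (end M e) ≡ x ⊎ proj₂ (end M e) ≡ x

  isEndᵇ : Gr n m → Fin n → Fin m → Bool
  isEndᵇ M x e = (proj₁ (end M e) =ᵇ x) ∨ (proj₂ (end M e) =ᵇ x)

  Adj : Gr n m → Fin n → Fin n → Set
  Adj M x y = ∃[ e ] (e ∈ E M × Joins M e x y)

  -- degree of x in M (number of incident edges; graphs here are loop-free)
  deg : Gr n m → Fin n → ℕ
  deg M x = sumSel (E M) (λ e → if isEndᵇ M x e then 1 else 0)

  data Reach (M : Gr n m) : Fin n → Fin n → Set where
    here : ∀ {x} → x ∈ V M → Reach M x x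
    step : ∀ {x y z} (e : Fin m) → e ∈ E M → Joins M e x y →
           Reach M y z → Reach M x z

  Connected : Gr n m → Set
  Connected M = ∀ x y → x ∈ V M → y ∈ V M → Reach M x y

  delNodes : Gr n m → Subset n → Gr n m
  delNodes M S = gr
    (tabulate λ x → lookup (V M) x ∧ not (lookup S x))
    (tabulate λ e → lookup (E M) e ∧ not (lookup S (proj₁ (end M e)))
                                   ∧ not (lookup S (proj₂ (end M e))))
    (end M)

  delEdge : Gr n m → Fin m → Gr n m
  delEdge M f = gr (V M) (tabulate λ e → lookup (E M) e ∧ not (e =ᵇ f)) (end M)

  withEdges : Gr n m → Subset m → Gr n m
  withEdges M F = gr (V M) F (end M)

  induced : Gr n m → Subset n → Gr n m
  induced M T = gr T
    (tabulate λ e → lookup (E M) e ∧ lookup T (proj₁ (end M e))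
                                   ∧ lookup T (proj₂ (end M e)))
    (end M)

  -- M / S : identify the nodes of S into the node r (r ∈ S), deleting
  -- the edges with both ends in S.
  contract : Gr n m → Subset n → Fin n → Gr n m
  contract M S r = gr
    (tabulate λ x → (lookup (V M) x ∧ not (lookup S x)) ∨ (x =ᵇ r))
    (tabulate λ e → lookup (E M) e ∧ not (lookup S (proj₁ (end M e))
                                         ∧ lookup S (proj₂ (end M e))))
    (λ e → f (proj₁ (end M e)) , f (proj₂ (end M e)))
    where
    f : Fin n → Fin n
    f x = if lookup S x then r else x

  TwoEC : Gr n m → Set
  TwoEC M = ∣ V M ∣ ≥ 2 × Connected M
          × (∀ e → e ∈ E M → Connected (delEdge M e))

  TwoNC : Gr n m → Set
  TwoNC M = ∣ V M ∣ ≥ 3 × Connected M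
          × (∀ w → w ∈ V M → Connected (delNodes M ⁅ w ⁆))

  Bridge : Gr n m → Fin m → Set
  Bridge M e = e ∈ E M × ¬ Reach (delEdge M e) (proj₁ (end M e)) (proj₂ (end M e))

  OptAtLeast : (Fin m → ℕ) → Gr n m → ℕ → Set
  OptAtLeast c M k = ∀ F → F ⊆ E M → TwoEC (withEdges M F) → sumSel F c ≥ k

  Component : Gr n m → Subset n → Set
  Component M D = ∃[ x ] (x ∈ V M × (∀ y → (y ∈ D → y ∈ V M × Reach M x y)
                                        × (y ∈ V M × Reach M x y → y ∈ D)))

  -- the 2ec-w-block of M given by the component D of M - w
  wBlock : Gr n m → Fin n → Subset n → Gr n m
  wBlock M w D = induced M (⁅ w ⁆ ∪ D)

  TwoWBlocks : Gr n m → Fin n → (Gr n m → Set) → Set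
  TwoWBlocks M w P = ∃[ D₁ ] ∃[ D₂ ]
    ( Component (delNodes M ⁅ w ⁆) D₁ × Component (delNodes M ⁅ w ⁆) D₂
    × D₁ ≢ D₂ × P (wBlock M w D₁) × P (wBlock M w D₂))

  record Cycle (M : Gr n m) (k : ℕ) : Set where
    field
      node    : Fin k → Fin n
      edge    : Fin k → Fin m
      inj     : ∀ i j → node i ≡ node j → i ≡ j
      nodeIn  : ∀ i → node i ∈ V M
      edgeIn  : ∀ i → edge i ∈ E M
      joins   : ∀ i → Joins M (edge i) (node i) (node (next i))
  open Cycle public

  cycleCost : ∀ {M k} → (Fin m → ℕ) → Cycle M k → ℕ
  cycleCost {k = k} c C = sumFin k (λ i → c (edge C i))

  Attachment : Gr n m → Subset n → Fin n → Set
  Attachment G T x = x ∈ T × ∃[ y ] (y ∉ T × Adj G x y)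

record MAP (n m : ℕ) : Set where
  field
    ends      : Fin m → Fin n × Fin n
    cost      : Fin m → ℕ
    costBin   : ∀ e → cost e ≡ 0 ⊎ cost e ≡ 1
    loopFree  : ∀ e → proj₁ (ends e) ≢ proj₂ (ends e)
    matching  : ∀ e f → cost e ≡ 0 → cost f ≡ 0 → e ≢ f →
                ∀ x → ¬ (IsEnd (gr (Data.Fin.Subset.⊤) (Data.Fin.Subset.⊤) ends) x e
                          × IsEnd (gr (Data.Fin.Subset.⊤) (Data.Fin.Subset.⊤) ends) x f)
    twoEC     : TwoEC (gr Data.Fin.Subset.⊤ Data.Fin.Subset.⊤ ends)

module _ {n m : ℕ} (I : MAP n m) where
  open MAP I

  Gof : Gr n m
  Gof = gr Data.Fin.Subset.⊤ Data.Fin.Subset.⊤ ends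

  HasParallel : Gr n m → Set
  HasParallel M = ∃[ e ] ∃[ f ] (e ∈ E M × f ∈ E M × e ≢ f
                    × Joins M f (proj₁ (end M e)) (proj₂ (end M e)))

  CutNode : Gr n m → Fin n → Set
  CutNode M w = w ∈ V M × ¬ Connected (delNodes M ⁅ w ⁆)

  endSet : Fin m → Subset n
  endSet e = ⁅ proj₁ (ends e) ⁆ ∪ ⁅ proj₂ (ends e) ⁆

  ZeroS2 : Fin m → Set
  ZeroS2 e = cost e ≡ 0 × ¬ Connected (delNodes Gof (endSet e))

  UnitS2 : Fin m → Set
  UnitS2 e = cost e ≡ 1 × ¬ Connected (delNodes Gof (endSet e))
           × TwoWBlocks Mc w (λ B → OptAtLeast cost B 3
                × ∃[ f ] (f ∈ E B × cost f ≡ 0 × IsEnd B w f))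
    where
    w  = proj₁ (ends e)
    Mc = contract Gof (endSet e) w

  S34 : Subset n → Set
  S34 T = TwoNC C × (∣ T ∣ ≡ 3 ⊎ ∣ T ∣ ≡ 4)
        × (Σ (Cycle C ∣ T ∣) λ Z → cycleCost cost Z ≡ 2)
        × ¬ Connected (delNodes Gof T)
        × (∀ e → (proj₁ (ends e) ∈ T × proj₂ (ends e) ∉ T) ⊎ (proj₁ (ends e) ∉ T × proj₂ (ends e) ∈ T)
                → cost e ≢ 0)
        × (∃[ r ] (r ∈ T × TwoWBlocks (contract Gof T r) r (λ B → OptAtLeast cost B 3)))
    where
    C = induced Gof T

  R4 : Subset n → Set
  R4 T = ∣ T ∣ ≡ 4 × T ≢ Data.Fin.Subset.⊤
       × (Σ (Cycle C 4) λ Z → cycleCost cost Z ≡ 2)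
       × ∃[ x ] ∃[ y ] (x ∈ T × y ∈ T × x ≢ y × ¬ Adj Gof x y
                        × deg Gof x ≡ 2 × deg Gof y ≡ 2)
    where
    C = induced Gof T

  R8 : Subset n → Set
  R8 T = ∣ T ∣ ≡ 8 × T ≢ Data.Fin.Subset.⊤
       × Σ (Cycle C 4) λ C₁ → Σ (Cycle C 4) λ C₂ → ∃[ a₁ ] ∃[ a₂ ]
         ( cycleCost cost C₁ ≡ 2 × cycleCost cost C₂ ≡ 2
         × (∀ i j → node C₁ i ≢ node C₂ j)
         × (∃[ i ] node C₁ i ≡ a₁) × (∃[ j ] node C₂ j ≡ a₂)
         × Attachment Gof T a₁ × Attachment Gof T a₂
         × (∀ x → Attachment Gof T x → x ≡ a₁ ⊎ x ≡ a₂)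
         -- the unit-edge of C₁ - a₁ has both ends adjacent to V(C₂)
         × (∀ i → cost (edge C₁ i) ≡ 1 → ¬ IsEnd Gof a₁ (edge C₁ i) →
              ∀ x → IsEnd Gof x (edge C₁ i) → ∃[ j ] Adj Gof x (node C₂ j))
         × (∀ i → cost (edge C₂ i) ≡ 1 → ¬ IsEnd Gof a₂ (edge C₂ i) →
              ∀ x → IsEnd Gof x (edge C₂ i) → ∃[ j ] Adj Gof x (node C₁ j)))
    where
    C = induced Gof T

  WellStructured : Set
  WellStructured = n ≥ 12
    × (∀ w → ¬ CutNode Gof w)
    × ¬ HasParallel Gof
    × (∀ e → ¬ ZeroS2 e)
    × (∀ e → ¬ UnitS2 e)
    × (∀ T → ¬ S34 T)
    × (∀ T → ¬ R4 T)
    × (∀ T → ¬ R8 T)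

  GoodH : Subset m → Set
  GoodH F = (∀ e → cost e ≡ 0 → e ∈ F)
          × ¬ HasParallel (withEdges Gof F)
          × (∀ e → ¬ Bridge (withEdges Gof F) e)
          × (∀ x → deg (withEdges Gof F) x ≥ 2)

  SubgraphOf : Gr n m → Gr n m → Set
  SubgraphOf K M = V K ⊆ V M × E K ⊆ E M × end K ≡ end M
                 × (∀ e → e ∈ E K → proj₁ (end K e) ∈ V K × proj₂ (end K e) ∈ V K)

  BlockLike : Gr n m → Set
  BlockLike K = Connected K × ∣ V K ∣ ≥ 2 × (∀ e → ¬ Bridge K e)

  TwoECBlock : Gr n m → Gr n m → Set
  TwoECBlock M K = SubgraphOf K M × BlockLike K
    × (∀ K' → SubgraphOf K' M → BlockLike K' → V K ⊆ V K' → E K ⊆ E K' → K' ≡ K)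

  unitCount : Gr n m → ℕ
  unitCount K = sumSel (E K) (λ e → if ⌊ cost e ℕ.≟ 1 ⌋ then 1 else 0)

  Small : Gr n m → Set
  Small K = unitCount K ≤ 2

  Large : Gr n m → Set
  Large K = ¬ Small K

  Γ : Subset n → Fin n → Set
  Γ S y = y ∉ S × ∃[ x ] (x ∈ S × Adj Gof x y)

-- Suppose B is small too. Every node of H has two distinct neighbours and the zero-edges form a
-- matching, so every node of a small 2ec-block lies on one of its at most two unit edges; hence a
-- small block is spanned by a triangle or a 4-cycle of cost two, and its node set induces a 2NC
-- subgraph of three or four nodes. As n ≥ 12, some node z lies outside V(A) ∪ V(B), and as
-- Γ(V(A)) ⊆ V(B), deleting V(B) separates A from z. The 2ec-blocks of H are its components, so no
-- zero-edge leaves V(B); hence in G / V(B) every edge at the contracted node is a unit edge, and the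
-- 2ec-blocks through the components of A and of z both have opt ≥ 3. So V(B) is an S{3,4}, which a
-- well-structured instance does not contain.

module Submission where

open import Defs
open import Data.Bool using (Bool; true; false; T; _∧_; _∨_; not; if_then_else_)
open import Data.Bool.Properties using (T-≡; T-∨)
open import Data.Empty using (⊥; ⊥-elim)
open import Data.Fin as Fin using (Fin)
import Data.Fin.Properties as FinP
open import Data.Fin.Subset using (Subset; _∈_; _∉_; _⊆_; ⁅_⁆; _∪_; ∣_∣; ⊤)
open import Data.Fin.Subset.Properties
  using (_∈?_; ∈⊤; x∈⁅x⁆; x∈⁅y⁆⇒x≡y; x≢y⇒x∉⁅y⁆; x∈p∪q⁺; ∣⊤∣≡n; ∣p∣≤∣x∷p∣; p⊆q⇒∣p∣≤∣q∣)
open import Data.List as List using (List; []; _∷_; length; map)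
open import Data.List.Membership.Propositional using () renaming (_∈_ to _∈ₗ_)
open import Data.List.Membership.Propositional.Properties using (∈-tabulate⁺)
import Data.List.Membership.DecPropositional as DecMembership
open import Data.List.Properties using (length-tabulate)
open import Data.List.Relation.Unary.All as All using (All; []; _∷_)
open import Data.List.Relation.Unary.All.Properties using (¬Any⇒All¬) renaming (tabulate⁺ to All-tabulate⁺)
open import Data.List.Relation.Unary.Any using (here; there)
open import Data.List.Relation.Unary.Unique.Propositional using (Unique; []; _∷_)
import Data.List.Relation.Unary.Unique.Propositional.Properties as Unique
open import Data.Nat as ℕ using (ℕ; zero; suc; _+_; _≤_; _<_; _≥_; z≤n; s≤s)
open import Data.Nat.ListAction using (sum)
open import Data.Nat.Properties
open import Algebra.Properties.CommutativeSemigroup +-commutativeSemigroup using (x∙yz≈y∙xz)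
open import Data.Product using (Σ; ∃-syntax; _×_; _,_; proj₁; proj₂)
open import Data.Product.Properties using (≡-dec)
open import Data.Sum using (_⊎_; inj₁; inj₂; [_,_]′)
open import Data.Vec using (Vec; []; _∷_; lookup; tabulate; here; there; _[_]≔_)
open import Data.Vec.Properties using (lookup∘tabulate; []=⇒lookup; lookup⇒[]=)
open import Data.Vec.Relation.Unary.All using ([]; _∷_)
open import Data.Vec.Relation.Unary.AllPairs using ([]; _∷_)
import Data.Vec.Relation.Unary.Unique.Propositional as VecUnique
import Data.Vec.Relation.Unary.Unique.Propositional.Properties as VecUnique
open import Function using (_∘_; case_of_)
open import Function.Bundles using (Equivalence)
open import Relation.Binary.PropositionalEquality
open import Relation.Nullary using (¬_; ¬?; Dec; yes; no; contradiction)
open import Relation.Nullary.Decidable using (_×-dec_; _⊎-dec_; _→-dec_; does; toWitness; ⌊_⌋)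

private
  variable
    k : ℕ
    x y : Fin k
    p q : Subset k

∈⇒T : x ∈ p → T (lookup p x)
∈⇒T = Equivalence.from T-≡ ∘ []=⇒lookup

T⇒∈ : T (lookup p x) → x ∈ p
T⇒∈ = lookup⇒[]= _ _ ∘ Equivalence.to T-≡

∉⇒T-not : x ∉ p → T (not (lookup p x))
∉⇒T-not {x = x} {p = p} x∉p with lookup p x in eq
... | true  = x∉p (lookup⇒[]= x p eq)
... | false = _

T-not⇒∉ : T (not (lookup p x)) → x ∉ p
T-not⇒∉ t x∈p = subst (T ∘ not) ([]=⇒lookup x∈p) t

T-not⇒¬T : ∀ {b} → T (not b) → ¬ T b
T-not⇒¬T {true} () _

T-∨⁺ˡ : ∀ {a} b → T a → T (a ∨ b)
T-∨⁺ˡ {true} _ _ = _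

T-∧⁺ : ∀ {a b} → T a → T b → T (a ∧ b)
T-∧⁺ {true} {true} _ _ = _

T-∧⁻ : ∀ {a b} → T (a ∧ b) → T a × T b
T-∧⁻ {true} {true} _ = _ , _

T⇒∈-tabulate : {f : Fin k → Bool} → T (f x) → x ∈ tabulate f
T⇒∈-tabulate {x = x} {f} t = T⇒∈ (subst T (sym (lookup∘tabulate f x)) t)

∈-tabulate⇒T : {f : Fin k → Bool} → x ∈ tabulate f → T (f x)
∈-tabulate⇒T {x = x} {f} x∈ = subst T (lookup∘tabulate f x) (∈⇒T x∈)

T-=ᵇ : T (x =ᵇ y) → x ≡ y
T-=ᵇ {x = x} {y} t with x Fin.≟ y
... | yes x≡y = x≡y

≢⇒T-not-=ᵇ : x ≢ y → T (not (x =ᵇ y))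
≢⇒T-not-=ᵇ {x = x} {y} x≢y with x Fin.≟ y
... | yes x≡y = x≢y x≡y
... | no _    = _

T-not-=ᵇ⇒≢ : T (not (x =ᵇ y)) → x ≢ y
T-not-=ᵇ⇒≢ {x = x} t refl with x Fin.≟ x
... | yes _   = t
... | no x≢x = x≢x refl

∈-[]≔false⁺ : x ∈ p → x ≢ y → x ∈ p [ y ]≔ false
∈-[]≔false⁺ {y = Fin.zero}  here       x≢y = contradiction refl x≢y
∈-[]≔false⁺ {y = Fin.suc y} here       x≢y = here
∈-[]≔false⁺ {y = Fin.zero}  (there x∈) x≢y = there x∈
∈-[]≔false⁺ {y = Fin.suc y} (there x∈) x≢y = there (∈-[]≔false⁺ x∈ (x≢y ∘ cong Fin.suc))

∈-[]≔false⁻ : x ∈ p [ y ]≔ false → x ∈ p × x ≢ y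
∈-[]≔false⁻ {p = _ ∷ _} {Fin.zero}  (there x∈) = there x∈ , λ ()
∈-[]≔false⁻ {p = _ ∷ _} {Fin.suc y} here       = here , λ ()
∈-[]≔false⁻ {p = _ ∷ _} {Fin.suc y} (there x∈) with ∈-[]≔false⁻ x∈
... | x∈p , x≢y = there x∈p , x≢y ∘ FinP.suc-injective

∉⇒[]≔false≡ : x ∉ p → p [ x ]≔ false ≡ p
∉⇒[]≔false≡ {x = Fin.zero}  {p = true ∷ p}  x∉p = contradiction here x∉p
∉⇒[]≔false≡ {x = Fin.zero}  {p = false ∷ p} x∉p = refl
∉⇒[]≔false≡ {x = Fin.suc x} {p = b ∷ p}     x∉p = cong (b ∷_) (∉⇒[]≔false≡ (x∉p ∘ there))

-- Counting over subsets

sumSel-∅ : ∀ (f : Fin k → ℕ) → (∀ {y} → y ∉ p) → sumSel p f ≡ 0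
sumSel-∅ {p = []}        f empty = refl
sumSel-∅ {p = true ∷ p}  f empty = contradiction here empty
sumSel-∅ {p = false ∷ p} f empty = sumSel-∅ (f ∘ Fin.suc) (empty ∘ there)

sumSel-[]≔false : ∀ (f : Fin k → ℕ) → x ∈ p → sumSel p f ≡ f x + sumSel (p [ x ]≔ false) f
sumSel-[]≔false {p = true ∷ p} f here = refl
sumSel-[]≔false {x = Fin.suc x} {p = b ∷ p} f (there x∈p) =
  trans (cong (_ +_) (sumSel-[]≔false (f ∘ Fin.suc) x∈p))
        (x∙yz≈y∙xz (if b then f Fin.zero else 0) (f (Fin.suc x)) _)

sumSel≤-[]≔false : ∀ (f : Fin k → ℕ) x → sumSel p f ≤ f x + sumSel (p [ x ]≔ false) f
sumSel≤-[]≔false {p = p} f x with x ∈? p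
... | yes x∈p = ≤-reflexive (sumSel-[]≔false f x∈p)
... | no  x∉p rewrite ∉⇒[]≔false≡ x∉p = m≤n+m _ (f x)

sum≤sumSel : ∀ (f : Fin k → ℕ) {xs} → Unique xs → All (_∈ p) xs → sum (map f xs) ≤ sumSel p f
sum≤sumSel         f []            []            = z≤n
sum≤sumSel {p = p} f {x ∷ xs} (x∉xs ∷ u) (x∈p ∷ xs⊆p) = begin
  f x + sum (map f xs)             ≤⟨ +-monoʳ-≤ (f x) (sum≤sumSel f u xs⊆p∖x) ⟩
  f x + sumSel (p [ x ]≔ false) f  ≡⟨ sumSel-[]≔false f x∈p ⟨
  sumSel p f                       ∎
  where
  open ≤-Reasoning
  xs⊆p∖x : All (_∈ p [ x ]≔ false) xs
  xs⊆p∖x = All.zipWith (λ (x≢y , y∈p) → ∈-[]≔false⁺ y∈p (x≢y ∘ sym)) (x∉xs , xs⊆p)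

sumSel≤sum : ∀ (f : Fin k → ℕ) xs → (∀ {y} → y ∈ p → y ∈ₗ xs) → sumSel p f ≤ sum (map f xs)
sumSel≤sum f []       cover = ≤-reflexive (sumSel-∅ f (λ y∈p → case cover y∈p of λ ()))
sumSel≤sum {p = p} f (x ∷ xs) cover = begin
  sumSel p f                       ≤⟨ sumSel≤-[]≔false f x ⟩
  f x + sumSel (p [ x ]≔ false) f  ≤⟨ +-monoʳ-≤ (f x) (sumSel≤sum f xs cover∖x) ⟩
  f x + sum (map f xs)             ∎
  where
  open ≤-Reasoning
  cover∖x : ∀ {y} → y ∈ p [ x ]≔ false → y ∈ₗ xs
  cover∖x {y} y∈ with cover (proj₁ (∈-[]≔false⁻ y∈))
  ... | here y≡x   = contradiction y≡x (proj₂ (∈-[]≔false⁻ y∈))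
  ... | there y∈xs = y∈xs

sumSel-pos : ∀ (f : Fin k → ℕ) → 1 ≤ sumSel p f → ∃[ x ] (x ∈ p × 1 ≤ f x)
sumSel-pos {p = b ∷ p} f pos with b | f Fin.zero in eq
... | true | suc _ = Fin.zero , here , ≤-trans (s≤s z≤n) (≤-reflexive (sym eq))
... | true | zero with sumSel-pos (f ∘ Fin.suc) pos
...   | x , x∈p , fx = Fin.suc x , there x∈p , fx
sumSel-pos {p = b ∷ p} f pos | false | _ with sumSel-pos (f ∘ Fin.suc) pos
...   | x , x∈p , fx = Fin.suc x , there x∈p , fx

∣p∣≡sumSel : ∀ (p : Subset k) → ∣ p ∣ ≡ sumSel p (λ _ → 1)
∣p∣≡sumSel []          = refl
∣p∣≡sumSel (true ∷ p)  = cong suc (∣p∣≡sumSel p)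
∣p∣≡sumSel (false ∷ p) = ∣p∣≡sumSel p

sum-map-1 : ∀ {A : Set} (xs : List A) → sum (map (λ _ → 1) xs) ≡ length xs
sum-map-1 []       = refl
sum-map-1 (_ ∷ xs) = cong suc (sum-map-1 xs)

length≤∣p∣ : ∀ {xs : List (Fin k)} → Unique xs → All (_∈ p) xs → length xs ≤ ∣ p ∣
length≤∣p∣ {p = p} {xs} u xs⊆p =
  subst₂ _≤_ (sum-map-1 xs) (sym (∣p∣≡sumSel p)) (sum≤sumSel (λ _ → 1) u xs⊆p)

∣p∣≤length : ∀ (xs : List (Fin k)) → (∀ {y} → y ∈ p → y ∈ₗ xs) → ∣ p ∣ ≤ length xs
∣p∣≤length {p = p} xs cover =
  subst₂ _≤_ (sym (∣p∣≡sumSel p)) (sum-map-1 xs) (sumSel≤sum (λ _ → 1) xs cover)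

three≤sumSel : ∀ (f : Fin k → ℕ) {x y z} → x ≢ y → x ≢ z → y ≢ z → x ∈ p → y ∈ p → z ∈ p →
               f x ≡ 1 → f y ≡ 1 → f z ≡ 1 → 3 ≤ sumSel p f
three≤sumSel {p = p} f x≢y x≢z y≢z x∈ y∈ z∈ fx fy fz =
  subst (_≤ sumSel p f) (cong₂ _+_ fx (cong₂ _+_ fy (cong (_+ 0) fz)))
        (sum≤sumSel f ((x≢y ∷ x≢z ∷ []) ∷ (y≢z ∷ []) ∷ [] ∷ []) (x∈ ∷ y∈ ∷ z∈ ∷ []))

∣p∣≥1⇒∃∈ : 1 ≤ ∣ p ∣ → ∃[ x ] x ∈ p
∣p∣≥1⇒∃∈ {p = p} ∣p∣≥1 with sumSel-pos (λ _ → 1) (subst (1 ≤_) (∣p∣≡sumSel p) ∣p∣≥1)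
... | x , x∈ , _ = x , x∈

avoid-two : (P : Fin k → Set) {x₀ x₁ x₂ y₁ y₂ : Fin k} → x₀ ≢ x₁ → x₀ ≢ x₂ → x₁ ≢ x₂ →
            P x₀ → P x₁ → P x₂ → ∃[ z ] (P z × z ≢ y₁ × z ≢ y₂)
avoid-two P {x₀} {x₁} {x₂} {y₁} {y₂} ≢₀₁ ≢₀₂ ≢₁₂ P₀ P₁ P₂ with x₀ Fin.≟ y₁ | x₀ Fin.≟ y₂
... | no x₀≢y₁ | no x₀≢y₂ = x₀ , P₀ , x₀≢y₁ , x₀≢y₂
... | yes refl | _ with x₁ Fin.≟ y₂
...   | no x₁≢y₂ = x₁ , P₁ , ≢₀₁ ∘ sym , x₁≢y₂
...   | yes refl = x₂ , P₂ , ≢₀₂ ∘ sym , ≢₁₂ ∘ sym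
avoid-two P {x₀} {x₁} {x₂} {y₁} {y₂} ≢₀₁ ≢₀₂ ≢₁₂ P₀ P₁ P₂ | no _ | yes refl with x₁ Fin.≟ y₁
...   | no x₁≢y₁ = x₁ , P₁ , x₁≢y₁ , ≢₀₁ ∘ sym
...   | yes refl = x₂ , P₂ , ≢₁₂ ∘ sym , ≢₀₂ ∘ sym

∣p∪q∣≤∣p∣+∣q∣ : ∀ (p q : Subset k) → ∣ p ∪ q ∣ ≤ ∣ p ∣ + ∣ q ∣
∣p∪q∣≤∣p∣+∣q∣ []          []          = z≤n
∣p∪q∣≤∣p∣+∣q∣ (true ∷ p)  (b ∷ q)     = s≤s (≤-trans (∣p∪q∣≤∣p∣+∣q∣ p q) (+-monoʳ-≤ ∣ p ∣ (∣p∣≤∣x∷p∣ b q)))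
∣p∪q∣≤∣p∣+∣q∣ (false ∷ p) (true ∷ q)  =
  ≤-trans (s≤s (∣p∪q∣≤∣p∣+∣q∣ p q)) (≤-reflexive (sym (+-suc ∣ p ∣ ∣ q ∣)))
∣p∪q∣≤∣p∣+∣q∣ (false ∷ p) (false ∷ q) = ∣p∪q∣≤∣p∣+∣q∣ p q

∃∉∪ : ∀ (p q : Subset k) → ∣ p ∣ + ∣ q ∣ < k → ∃[ z ] (z ∉ p × z ∉ q)
∃∉∪ {k} p q small with FinP.any? (λ z → ¬? (z ∈? p) ×-dec ¬? (z ∈? q))
... | yes found = found
... | no none = contradiction (≤-trans small (begin
  k                 ≡⟨ ∣⊤∣≡n k ⟨
  ∣ ⊤ {k} ∣         ≤⟨ p⊆q⇒∣p∣≤∣q∣ {p = ⊤} (λ {z} _ → x∈p∪q⁺ (covered z)) ⟩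
  ∣ p ∪ q ∣         ≤⟨ ∣p∪q∣≤∣p∣+∣q∣ p q ⟩
  ∣ p ∣ + ∣ q ∣     ∎)) (n≮n _)
  where
  open ≤-Reasoning
  covered : ∀ z → z ∈ p ⊎ z ∈ q
  covered z with z ∈? p | z ∈? q
  ... | yes z∈p | _       = inj₁ z∈p
  ... | no  _   | yes z∈q = inj₂ z∈q
  ... | no  z∉p | no  z∉q = contradiction (z , z∉p , z∉q) none

-- Walks

module _ {n m : ℕ} where

  private
    variable
      M M' : Gr n m
      e f : Fin m
      u v w z : Fin n

  EndsInside : Gr n m → Set
  EndsInside M = ∀ e → e ∈ E M → proj₁ (end M e) ∈ V M × proj₂ (end M e) ∈ V M

  Joins-sym : Joins M e u v → Joins M e v u
  Joins-sym (inj₁ eq) = inj₂ eq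
  Joins-sym (inj₂ eq) = inj₁ eq

  Joins⇒IsEnd : Joins M e u v → IsEnd M u e
  Joins⇒IsEnd (inj₁ eq) = inj₁ (cong proj₁ eq)
  Joins⇒IsEnd (inj₂ eq) = inj₂ (cong proj₂ eq)

  IsEnd⇒Joins : IsEnd M u e → ∃[ v ] Joins M e u v
  IsEnd⇒Joins {M = M} {e = e} (inj₁ eq) = proj₂ (end M e) , inj₁ (cong (_, _) eq)
  IsEnd⇒Joins {M = M} {e = e} (inj₂ eq) = proj₁ (end M e) , inj₂ (cong (_ ,_) eq)

  Joins-ends : Joins M e u v → Joins M e w z → w ≡ u ⊎ w ≡ v
  Joins-ends (inj₁ p) (inj₁ q) = inj₁ (cong proj₁ (trans (sym q) p))
  Joins-ends (inj₁ p) (inj₂ q) = inj₂ (cong proj₂ (trans (sym q) p))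
  Joins-ends (inj₂ p) (inj₁ q) = inj₂ (cong proj₁ (trans (sym q) p))
  Joins-ends (inj₂ p) (inj₂ q) = inj₁ (cong proj₂ (trans (sym q) p))

  not-through : Joins M e u v → Joins M f w z → w ≢ u → w ≢ v → f ≢ e
  not-through {M = M} jₑ j_f w≢u w≢v refl = [ w≢u , w≢v ]′ (Joins-ends {M = M} jₑ j_f)

  Joins-both⁺ : (P : Fin n → Set) → Joins M e u v → P u → P v →
               P (proj₁ (end M e)) × P (proj₂ (end M e))
  Joins-both⁺ P (inj₁ eq) Pu Pv rewrite eq = Pu , Pv
  Joins-both⁺ P (inj₂ eq) Pu Pv rewrite eq = Pv , Pu

  Joins-both⁻ : (P : Fin n → Set) → Joins M e u v → P (proj₁ (end M e)) → P (proj₂ (end M e)) → P u × P v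
  Joins-both⁻ P (inj₁ eq) P₁ P₂ rewrite eq = P₁ , P₂
  Joins-both⁻ P (inj₂ eq) P₁ P₂ rewrite eq = P₂ , P₁

  Joins-dec : ∀ (M : Gr n m) e u v → Dec (Joins M e u v)
  Joins-dec M e u v = ≡-dec Fin._≟_ Fin._≟_ (end M e) (u , v) ⊎-dec ≡-dec Fin._≟_ Fin._≟_ (end M e) (v , u)

  Reach-target : Reach M u v → v ∈ V M
  Reach-target (here v∈) = v∈
  Reach-target (step _ _ _ r) = Reach-target r

  Reach-trans : Reach M u v → Reach M v w → Reach M u w
  Reach-trans (here _)       s = s
  Reach-trans (step e i j r) s = step e i j (Reach-trans r s)

  Joins-source : EndsInside M → e ∈ E M → Joins M e u v → u ∈ V M
  Joins-source {M = M} {e = e} inside e∈ (inj₁ eq) = subst (_∈ V M) (cong proj₁ eq) (proj₁ (inside e e∈))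
  Joins-source {M = M} {e = e} inside e∈ (inj₂ eq) = subst (_∈ V M) (cong proj₂ eq) (proj₂ (inside e e∈))

  Reach-sym : EndsInside M → Reach M u v → Reach M v u
  Reach-sym inside (here u∈) = here u∈
  Reach-sym {M = M} inside (step e i j r) =
    Reach-trans (Reach-sym inside r) (step e i (Joins-sym {M = M} j) (here (Joins-source {M = M} inside i j)))

  hub-connected : ∀ {M : Gr n m} {h} → EndsInside M → (∀ x → x ∈ V M → Reach M h x) → Connected M
  hub-connected inside fromHub x y x∈ y∈ = Reach-trans (Reach-sym inside (fromHub x x∈)) (fromHub y y∈)

  Reach-preserves : (P : Fin n → Set) → (∀ {e u v} → e ∈ E M → Joins M e u v → P u → P v) →
                    Reach M u v → P u → P v
  Reach-preserves P closed (here _)       Pu = Pu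
  Reach-preserves P closed (step e i j r) Pu = Reach-preserves P closed r (closed i j Pu)

  Reach-transfer : (P : Fin n → Set) →
    (∀ {u} → u ∈ V M → P u → u ∈ V M') →
    (∀ {e u v} → e ∈ E M → Joins M e u v → P u → P v × e ∈ E M' × Joins M' e u v) →
    Reach M u v → P u → Reach M' u v
  Reach-transfer P node edge (here u∈)     Pu = here (node u∈ Pu)
  Reach-transfer P node edge (step e i j r) Pu with edge i j Pu
  ... | Pv , i' , j' = step e i' j' (Reach-transfer P node edge r Pv)

  walkNodes : Reach M u v → List (Fin n)
  walkNodes (here {x = u} _)       = u ∷ []
  walkNodes (step {x = u} _ _ _ r) = u ∷ walkNodes r

  walkLength : Reach M u v → ℕ
  walkLength (here _)       = 0
  walkLength (step _ _ _ r) = suc (walkLength r)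

  length-walkNodes : (r : Reach M u v) → length (walkNodes r) ≡ suc (walkLength r)
  length-walkNodes (here _)       = refl
  length-walkNodes (step _ _ _ r) = cong suc (length-walkNodes r)

  Path : Gr n m → Fin n → Fin n → Set
  Path M u v = Σ (Reach M u v) (Unique ∘ walkNodes)

  suffixPath : (r : Reach M v w) → Unique (walkNodes r) → u ∈ₗ walkNodes r → Path M u w
  suffixPath (here v∈)       u! (here refl) = here v∈ , u!
  suffixPath (step e i j r) u! (here refl) = step e i j r , u!
  suffixPath (step e i j r) (_ ∷ u!) (there u∈) = suffixPath r u! u∈

  open DecMembership (Fin._≟_ {n}) using () renaming (_∈?_ to _∈ₗ?_)

  shortcut : Reach M u v → Path M u v
  shortcut (here u∈) = here u∈ , [] ∷ []
  shortcut {u = u} (step e i j r) with shortcut r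
  ... | s , s! with u ∈ₗ? walkNodes s
  ...   | yes u∈s = suffixPath s s! u∈s
  ...   | no  u∉s = step e i j s , ¬Any⇒All¬ (walkNodes s) u∉s ∷ s!

  Path-length : ((s , s!) : Path M u v) → walkLength s < n
  Path-length (s , s!) = subst₂ _≤_ (length-walkNodes s) (∣⊤∣≡n n)
                                (length≤∣p∣ {p = ⊤} s! (All.universal (λ _ → ∈⊤) (walkNodes s)))

  Reach≤ : Gr n m → ℕ → Fin n → Fin n → Set
  Reach≤ M k u v = Σ (Reach M u v) λ r → walkLength r ≤ k

  Reach≤-dec : ∀ (M : Gr n m) k u v → Dec (Reach≤ M k u v)
  Reach≤-dec M zero u v with u Fin.≟ v | u ∈? V M
  ... | yes refl | yes u∈ = yes (here u∈ , z≤n)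
  ... | yes refl | no u∉  = no λ { (here u∈ , _) → u∉ u∈ }
  ... | no u≢v   | _      = no λ { (here _ , _) → u≢v refl }
  Reach≤-dec M (suc k) u v with Reach≤-dec M zero u v
     | FinP.any? (λ e → FinP.any? (λ w → e ∈? E M ×-dec Joins-dec M e u w ×-dec Reach≤-dec M k w v))
  ... | yes (r , r≤0) | _ = yes (r , ≤-trans r≤0 z≤n)
  ... | no _ | yes (e , w , i , j , r , r≤k) = yes (step e i j r , s≤s r≤k)
  ... | no ¬here | no ¬step = no λ
    { (here v∈ , _)               → ¬here (here v∈ , z≤n)
    ; (step e i j r , s≤s r≤k) → ¬step (e , _ , i , j , r , r≤k) }

  -- Every walk shortcuts to a path, which has fewer than n steps, so a bounded search suffices.
  Reach-dec : ∀ (M : Gr n m) u v → Dec (Reach M u v)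
  Reach-dec M u v with Reach≤-dec M n u v
  ... | yes (r , _) = yes r
  ... | no ¬r = no λ r → let s = shortcut r in ¬r (proj₁ s , <⇒≤ (Path-length s))

  component : Gr n m → Fin n → Subset n
  component M u = tabulate λ v → does (Reach-dec M u v)

  ∈-component⁺ : Reach M u v → v ∈ component M u
  ∈-component⁺ {M = M} {u = u} {v = v} r with Reach-dec M u v in eq
  ... | yes _ = T⇒∈-tabulate (subst (T ∘ does) (sym eq) _)
  ... | no ¬r = contradiction r ¬r

  ∈-component⁻ : v ∈ component M u → Reach M u v
  ∈-component⁻ {v = v} {M = M} {u = u} v∈ with Reach-dec M u v | ∈-tabulate⇒T {x = v} v∈
  ... | yes r | _ = r

module _ {n m : ℕ} {M : Gr n m} where

  private
    variable
      S : Subset n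
      u : Fin n
      e f : Fin m

  ∈V-delNodes⁺ : u ∈ V M → u ∉ S → u ∈ V (delNodes M S)
  ∈V-delNodes⁺ u∈ u∉ = T⇒∈-tabulate (T-∧⁺ (∈⇒T u∈) (∉⇒T-not u∉))

  ∈V-delNodes⁻ : u ∈ V (delNodes M S) → u ∈ V M × u ∉ S
  ∈V-delNodes⁻ u∈ with T-∧⁻ (∈-tabulate⇒T u∈)
  ... | t₁ , t₂ = T⇒∈ t₁ , T-not⇒∉ t₂

  ∈E-delNodes⁺ : e ∈ E M → proj₁ (end M e) ∉ S → proj₂ (end M e) ∉ S → e ∈ E (delNodes M S)
  ∈E-delNodes⁺ e∈ ∉₁ ∉₂ = T⇒∈-tabulate (T-∧⁺ (∈⇒T e∈) (T-∧⁺ (∉⇒T-not ∉₁) (∉⇒T-not ∉₂)))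

  ∈E-delNodes⁻ : e ∈ E (delNodes M S) → e ∈ E M × proj₁ (end M e) ∉ S × proj₂ (end M e) ∉ S
  ∈E-delNodes⁻ e∈ with T-∧⁻ (∈-tabulate⇒T e∈)
  ... | t₁ , t₂ with T-∧⁻ t₂
  ...   | t₂₁ , t₂₂ = T⇒∈ t₁ , T-not⇒∉ t₂₁ , T-not⇒∉ t₂₂

  ∈E-induced⁺ : e ∈ E M → proj₁ (end M e) ∈ S → proj₂ (end M e) ∈ S → e ∈ E (induced M S)
  ∈E-induced⁺ e∈ ∈₁ ∈₂ = T⇒∈-tabulate (T-∧⁺ (∈⇒T e∈) (T-∧⁺ (∈⇒T ∈₁) (∈⇒T ∈₂)))

  ∈E-induced⁻ : e ∈ E (induced M S) → e ∈ E M × proj₁ (end M e) ∈ S × proj₂ (end M e) ∈ S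
  ∈E-induced⁻ e∈ with T-∧⁻ (∈-tabulate⇒T e∈)
  ... | t₁ , t₂ with T-∧⁻ t₂
  ...   | t₂₁ , t₂₂ = T⇒∈ t₁ , T⇒∈ t₂₁ , T⇒∈ t₂₂

  ∈E-delEdge⁺ : e ∈ E M → e ≢ f → e ∈ E (delEdge M f)
  ∈E-delEdge⁺ e∈ e≢f = T⇒∈-tabulate (T-∧⁺ (∈⇒T e∈) (≢⇒T-not-=ᵇ e≢f))

  ∈E-delEdge⁻ : e ∈ E (delEdge M f) → e ∈ E M × e ≢ f
  ∈E-delEdge⁻ e∈ with T-∧⁻ (∈-tabulate⇒T e∈)
  ... | t₁ , t₂ = T⇒∈ t₁ , T-not-=ᵇ⇒≢ t₂

  induced-EndsInside : EndsInside (induced M S)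
  induced-EndsInside e e∈ = proj₂ (∈E-induced⁻ e∈)

  delNodes-EndsInside : EndsInside M → EndsInside (delNodes M S)
  delNodes-EndsInside {S = S} inside e e∈ with ∈E-delNodes⁻ {S = S} e∈
  ... | e∈M , ∉₁ , ∉₂ = ∈V-delNodes⁺ (proj₁ (inside e e∈M)) ∉₁ , ∈V-delNodes⁺ (proj₂ (inside e e∈M)) ∉₂

module _ {n m : ℕ} where

  record TwoEdgesAt (M : Gr n m) (u : Fin n) : Set where
    field
      edge₁ edge₂ : Fin m
      nbr₁ nbr₂   : Fin n
      edge₁∈      : edge₁ ∈ E M
      edge₂∈      : edge₂ ∈ E M
      edge₁≢edge₂ : edge₁ ≢ edge₂
      joins₁      : Joins M edge₁ u nbr₁
      joins₂      : Joins M edge₂ u nbr₂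

  otherEdge : ∀ {M u} → TwoEdgesAt M u → ∀ e → ∃[ f ] ∃[ v ] (f ∈ E M × f ≢ e × Joins M f u v)
  otherEdge two e with TwoEdgesAt.edge₁ two Fin.≟ e
  ... | yes refl = edge₂ , nbr₂ , edge₂∈ , edge₁≢edge₂ ∘ sym , joins₂ where open TwoEdgesAt two
  ... | no ≢e    = edge₁ , nbr₁ , edge₁∈ , ≢e , joins₁ where open TwoEdgesAt two

  private
    incidence : Gr n m → Fin n → Fin m → ℕ
    incidence M u e = if isEndᵇ M u e then 1 else 0

    incidence≤1 : ∀ M u e → incidence M u e ≤ 1
    incidence≤1 M u e with isEndᵇ M u e
    ... | true  = ≤-refl
    ... | false = z≤n

    incidence⇒IsEnd : ∀ {M u e} → 1 ≤ incidence M u e → IsEnd M u e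
    incidence⇒IsEnd {M} {u} {e} inc with isEndᵇ M u e in eq
    ... | true with proj₁ (end M e) =ᵇ u in eq₁
    ...   | true  = inj₁ (T-=ᵇ (subst T (sym eq₁) _))
    ...   | false = inj₂ (T-=ᵇ (subst T (sym eq) _))

    deg-rest : ∀ {M u e} → deg M u ≥ 2 → e ∈ E M → 1 ≤ sumSel (E M [ e ]≔ false) (incidence M u)
    deg-rest {M} {u} {e} deg≥2 e∈ = +-cancelˡ-≤ 1 1 _ (begin
      2                                                   ≤⟨ deg≥2 ⟩
      deg M u                                             ≡⟨ sumSel-[]≔false (incidence M u) e∈ ⟩
      incidence M u e + sumSel (E M [ e ]≔ false) (incidence M u) ≤⟨ +-monoˡ-≤ _ (incidence≤1 M u e) ⟩
      1 + sumSel (E M [ e ]≔ false) (incidence M u)       ∎)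
      where open ≤-Reasoning

  deg≥2⇒TwoEdgesAt : ∀ {M u} → deg M u ≥ 2 → TwoEdgesAt M u
  deg≥2⇒TwoEdgesAt {M} {u} deg≥2 with sumSel-pos (incidence M u) (≤-trans (s≤s z≤n) deg≥2)
  ... | e₁ , e₁∈ , inc₁ with sumSel-pos (incidence M u) (deg-rest {M = M} deg≥2 e₁∈)
  ... | e₂ , e₂∈ , inc₂ with ∈-[]≔false⁻ e₂∈
  ...   | e₂∈E , e₂≢e₁ with IsEnd⇒Joins {M = M} (incidence⇒IsEnd {M = M} inc₁)
                          | IsEnd⇒Joins {M = M} (incidence⇒IsEnd {M = M} inc₂)
  ...     | v₁ , j₁ | v₂ , j₂ = record
    { edge₁ = e₁ ; edge₂ = e₂ ; nbr₁ = v₁ ; nbr₂ = v₂ ; edge₁∈ = e₁∈ ; edge₂∈ = e₂∈E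
    ; edge₁≢edge₂ = e₂≢e₁ ∘ sym ; joins₁ = j₁ ; joins₂ = j₂ }

  firstEdge : ∀ {M : Gr n m} {u v} → Reach M u v → u ≢ v → ∃[ e ] ∃[ w ] (e ∈ E M × Joins M e u w)
  firstEdge (here _)                  u≢u = contradiction refl u≢u
  firstEdge (step {y = w} e e∈ j _) _   = e , w , e∈ , j

  TwoEC⇒TwoEdgesAt : ∀ {M : Gr n m} {u v} → TwoEC M → u ∈ V M → v ∈ V M → u ≢ v → TwoEdgesAt M u
  TwoEC⇒TwoEdgesAt {M} (_ , conn , conn-e) u∈ v∈ u≢v with firstEdge (conn _ _ u∈ v∈) u≢v
  ... | e₁ , v₁ , e₁∈ , j₁ with firstEdge (conn-e e₁ e₁∈ _ _ u∈ v∈) u≢v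
  ... | e₂ , v₂ , e₂∈ , j₂ with ∈E-delEdge⁻ {M = M} {f = e₁} e₂∈
  ...   | e₂∈E , e₂≢e₁ = record
    { edge₁ = e₁ ; edge₂ = e₂ ; nbr₁ = v₁ ; nbr₂ = v₂ ; edge₁∈ = e₁∈ ; edge₂∈ = e₂∈E
    ; edge₁≢edge₂ = e₂≢e₁ ∘ sym ; joins₁ = j₁ ; joins₂ = j₂ }

-- Spanning cycles of length three and four

advance : ∀ {k} → ℕ → Fin k → Fin k
advance zero    i = i
advance (suc d) i = advance d (next i)

next-advance : ∀ {k} d (i : Fin k) → next (advance d i) ≡ advance d (next i)
next-advance zero    i = refl
next-advance (suc d) i = next-advance d (next i)

record Rotation (k : ℕ) : Set where
  field
    reach           : ∀ (i j : Fin k) → ∃[ d ] (d < k × advance d i ≡ j)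
    no-early-return : ∀ (i : Fin k) {d} → d < k → advance d i ≡ i → d ≡ 0

private
  reaches? : ∀ k → Dec (∀ (i j : Fin k) → ∃[ d ] advance (Fin.toℕ {k} d) i ≡ j)
  reaches? k = FinP.all? λ i → FinP.all? λ j → FinP.any? λ d → advance (Fin.toℕ d) i Fin.≟ j

  returns? : ∀ k → Dec (∀ (i d : Fin k) → advance (Fin.toℕ d) i ≡ i → Fin.toℕ d ≡ 0)
  returns? k = FinP.all? λ i → FinP.all? λ d → (advance (Fin.toℕ d) i Fin.≟ i) →-dec (Fin.toℕ d ℕ.≟ 0)

  toRotation : ∀ {k} → (∀ (i j : Fin k) → ∃[ d ] advance (Fin.toℕ d) i ≡ j) →
               (∀ (i d : Fin k) → advance (Fin.toℕ d) i ≡ i → Fin.toℕ d ≡ 0) → Rotation k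
  toRotation R Q = record
    { reach           = λ i j → let d , eq = R i j in Fin.toℕ d , FinP.toℕ<n d , eq
    ; no-early-return = λ i {d} d<k eq →
        let toℕ-d′ = FinP.toℕ-fromℕ< d<k in
        trans (sym toℕ-d′) (Q i (Fin.fromℕ< d<k) (subst (λ d → advance d i ≡ i) (sym toℕ-d′) eq)) }

-- For a fixed k both fields of Rotation k are finite checks, decided by evaluation.
rotation : ∀ {k} → k ≡ 3 ⊎ k ≡ 4 → Rotation k
rotation (inj₁ refl) = toRotation (toWitness {a? = reaches? 3} _) (toWitness {a? = returns? 3} _)
rotation (inj₂ refl) = toRotation (toWitness {a? = reaches? 4} _) (toWitness {a? = returns? 4} _)

module _ {n m k : ℕ} {M : Gr n m} {T : Subset n} (Z : Cycle (induced M T) k)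
         (onto : ∀ {w} → w ∈ T → ∃[ i ] node Z i ≡ w) where

  private
    C = induced M T

  spanning-card : ∣ T ∣ ≡ k
  spanning-card = ≤-antisym
    (subst (∣ T ∣ ≤_) (length-tabulate (node Z)) (∣p∣≤length (List.tabulate (node Z)) cover))
    (subst (_≤ ∣ T ∣) (length-tabulate (node Z))
           (length≤∣p∣ (Unique.tabulate⁺ (inj Z _ _)) (All-tabulate⁺ (nodeIn Z))))
    where
    cover : ∀ {w} → w ∈ T → w ∈ₗ List.tabulate (node Z)
    cover w∈ with onto w∈
    ... | i , refl = ∈-tabulate⁺ i

  walkAlong : (M' : Gr n m) → (∀ i → Joins M' (edge Z i) (node Z i) (node Z (next i))) →
              ∀ g i → (∀ d → d < g → edge Z (advance d i) ∈ E M') → node Z (advance g i) ∈ V M' →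
              Reach M' (node Z i) (node Z (advance g i))
  walkAlong M' joins′ zero    i edges v∈ = here v∈
  walkAlong M' joins′ (suc g) i edges v∈ =
    step (edge Z i) (edges 0 (s≤s z≤n)) (joins′ i)
         (walkAlong M' joins′ g (next i) (λ d d<g → edges (suc d) (s≤s d<g)) v∈)

  spanning-connected : Rotation k → Connected C
  spanning-connected rot x y x∈ y∈ with onto x∈ | onto y∈
  ... | i , refl | j , refl with Rotation.reach rot i j
  ... | d , _ , refl = walkAlong C (joins Z) d i (λ _ _ → edgeIn Z _) (nodeIn Z _)

  spanning-connected-minus : Rotation k → ∀ {w} → w ∈ T → Connected (delNodes C ⁅ w ⁆)
  spanning-connected-minus rot w∈ with onto w∈
  ... | i , refl =
    hub-connected {M = C-w} (delNodes-EndsInside {M = C} {S = ⁅ node Z i ⁆} (induced-EndsInside {M = M} {S = T}))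
                  fromHub
    where
    C-w = delNodes C ⁅ node Z i ⁆
    open Rotation rot

    avoids : ∀ {d} → 0 < d → d < k → node Z (advance d i) ∉ ⁅ node Z i ⁆
    avoids {suc d} _ d<k eq with no-early-return i d<k (inj Z _ _ (x∈⁅y⁆⇒x≡y _ eq))
    ... | ()

    in-C-w : ∀ {d} → 0 < d → d < k → node Z (advance d i) ∈ V C-w
    in-C-w 0<d d<k = ∈V-delNodes⁺ {M = C} (nodeIn Z _) (avoids 0<d d<k)

    fromHub : ∀ x → x ∈ V C-w → Reach C-w (node Z (next i)) x
    fromHub x x∈ with ∈V-delNodes⁻ {M = C} {S = ⁅ node Z i ⁆} x∈
    ... | x∈T , x∉w with onto x∈T
    ... | j , refl with reach i j
    ... | zero  , _   , refl = contradiction (x∈⁅x⁆ (node Z i)) x∉w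
    ... | suc g , g<k , refl = walkAlong C-w (joins Z) g (next i) edges (in-C-w (s≤s z≤n) g<k)
      where
      edges : ∀ d → d < g → edge Z (advance d (next i)) ∈ E C-w
      edges d d<g with Joins-both⁺ {M = C} (_∉ ⁅ node Z i ⁆) (joins Z (advance d (next i)))
                         (avoids (s≤s z≤n) (≤-trans (s≤s (s≤s (<⇒≤ d<g))) g<k))
                         (subst (λ v → node Z v ∉ ⁅ node Z i ⁆) (sym (next-advance d (next i)))
                                (avoids (s≤s z≤n) (≤-trans (s≤s (s≤s d<g)) g<k)))
      ... | ∉₁ , ∉₂ = ∈E-delNodes⁺ {M = C} (edgeIn Z _) ∉₁ ∉₂

  spanning-TwoNC : k ≡ 3 ⊎ k ≡ 4 → TwoNC C
  spanning-TwoNC k≡3⊎4 =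
    subst (_≥ 3) (sym spanning-card) (3≤k k≡3⊎4) , spanning-connected rot , λ _ → spanning-connected-minus rot
    where
    rot = rotation k≡3⊎4
    3≤k : k ≡ 3 ⊎ k ≡ 4 → 3 ≤ k
    3≤k (inj₁ refl) = ≤-refl
    3≤k (inj₂ refl) = n≤1+n 3

-- The instance graph G and the spanning subgraph H

module _ {n m : ℕ} (I : MAP n m) where
  open MAP I

  private
    G = Gof I
    variable
      e f : Fin m
      u v w u′ v′ : Fin n

  Joins⇒≢ : Joins G e u v → u ≢ v
  Joins⇒≢ {e = e} (inj₁ eq) refl = loopFree e (trans (cong proj₁ eq) (sym (cong proj₂ eq)))
  Joins⇒≢ {e = e} (inj₂ eq) refl = loopFree e (trans (cong proj₁ eq) (sym (cong proj₂ eq)))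

  zero-edges-disjoint : cost e ≡ 0 → cost f ≡ 0 → e ≢ f → Joins G e u v → Joins G f u w → ⊥
  zero-edges-disjoint c₁ c₂ e≢f j₁ j₂ =
    matching _ _ c₁ c₂ e≢f _ (Joins⇒IsEnd {M = G} j₁ , Joins⇒IsEnd {M = G} j₂)

  record SpanningCycle (T : Subset n) (k : ℕ) : Set where
    field
      cycle  : Cycle (induced G T) k
      cost≡2 : cycleCost cost cycle ≡ 2
      onto   : ∀ {w} → w ∈ T → ∃[ i ] node cycle i ≡ w

  vecCycle : ∀ {T k} (ns : Vec (Fin n) k) (es : Vec (Fin m) k) → VecUnique.Unique ns →
             (∀ i → lookup ns i ∈ T) → (∀ i → Joins G (lookup es i) (lookup ns i) (lookup ns (next i))) →
             sumFin k (cost ∘ lookup es) ≡ 2 → (∀ {w} → w ∈ T → ∃[ i ] lookup ns i ≡ w) →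
             SpanningCycle T k
  vecCycle {T} ns es ns! ns⊆T js cost≡2 onto = record
    { cycle  = record
      { node = lookup ns ; edge = lookup es ; inj = VecUnique.lookup-injective ns! ; nodeIn = ns⊆T
      ; edgeIn = λ i → let ends∈ = Joins-both⁺ {M = G} (_∈ T) (js i) (ns⊆T i) (ns⊆T (next i))
                       in ∈E-induced⁺ {M = G} ∈⊤ (proj₁ ends∈) (proj₂ ends∈)
      ; joins = js }
    ; cost≡2 = cost≡2
    ; onto   = onto }

  triangle : ∀ {T a b c eab ebc eca} → a ≢ b → a ≢ c → b ≢ c →
             Joins G eab a b → Joins G ebc b c → Joins G eca c a →
             cost eab + (cost ebc + (cost eca + 0)) ≡ 2 → a ∈ T → b ∈ T → c ∈ T →
             (∀ {w} → w ∈ T → w ≡ a ⊎ w ≡ b ⊎ w ≡ c) → SpanningCycle T 3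
  triangle {a = a} {b} {c} {eab} {ebc} {eca} a≢b a≢c b≢c jab jbc jca cost≡2 a∈ b∈ c∈ cover =
    vecCycle ns (eab ∷ ebc ∷ eca ∷ []) ((a≢b ∷ a≢c ∷ []) ∷ (b≢c ∷ []) ∷ [] ∷ []) ns⊆T js cost≡2 onto
    where
    ns = a ∷ b ∷ c ∷ []
    ns⊆T : ∀ i → lookup ns i ∈ _
    ns⊆T Fin.zero = a∈
    ns⊆T (Fin.suc Fin.zero) = b∈
    ns⊆T (Fin.suc (Fin.suc Fin.zero)) = c∈
    js : ∀ i → Joins G (lookup (eab ∷ ebc ∷ eca ∷ []) i) (lookup ns i) (lookup ns (next i))
    js Fin.zero = jab
    js (Fin.suc Fin.zero) = jbc
    js (Fin.suc (Fin.suc Fin.zero)) = jca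
    onto : ∀ {w} → w ∈ _ → ∃[ i ] lookup ns i ≡ w
    onto w∈ with cover w∈
    ... | inj₁ refl        = Fin.zero , refl
    ... | inj₂ (inj₁ refl) = Fin.suc Fin.zero , refl
    ... | inj₂ (inj₂ refl) = Fin.suc (Fin.suc Fin.zero) , refl

  square : ∀ {T a b c d eab ebc ecd eda} → a ≢ b → a ≢ c → a ≢ d → b ≢ c → b ≢ d → c ≢ d →
           Joins G eab a b → Joins G ebc b c → Joins G ecd c d → Joins G eda d a →
           cost eab + (cost ebc + (cost ecd + (cost eda + 0))) ≡ 2 → a ∈ T → b ∈ T → c ∈ T → d ∈ T →
           (∀ {w} → w ∈ T → w ≡ a ⊎ w ≡ b ⊎ w ≡ c ⊎ w ≡ d) → SpanningCycle T 4
  square {a = a} {b} {c} {d} {eab} {ebc} {ecd} {eda}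
         a≢b a≢c a≢d b≢c b≢d c≢d jab jbc jcd jda cost≡2 a∈ b∈ c∈ d∈ cover =
    vecCycle ns (eab ∷ ebc ∷ ecd ∷ eda ∷ [])
             ((a≢b ∷ a≢c ∷ a≢d ∷ []) ∷ (b≢c ∷ b≢d ∷ []) ∷ (c≢d ∷ []) ∷ [] ∷ [])
             ns⊆T js cost≡2 onto
    where
    ns = a ∷ b ∷ c ∷ d ∷ []
    ns⊆T : ∀ i → lookup ns i ∈ _
    ns⊆T Fin.zero = a∈
    ns⊆T (Fin.suc Fin.zero) = b∈
    ns⊆T (Fin.suc (Fin.suc Fin.zero)) = c∈
    ns⊆T (Fin.suc (Fin.suc (Fin.suc Fin.zero))) = d∈
    js : ∀ i → Joins G (lookup (eab ∷ ebc ∷ ecd ∷ eda ∷ []) i) (lookup ns i) (lookup ns (next i))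
    js Fin.zero = jab
    js (Fin.suc Fin.zero) = jbc
    js (Fin.suc (Fin.suc Fin.zero)) = jcd
    js (Fin.suc (Fin.suc (Fin.suc Fin.zero))) = jda
    onto : ∀ {w} → w ∈ _ → ∃[ i ] lookup ns i ≡ w
    onto w∈ with cover w∈
    ... | inj₁ refl               = Fin.zero , refl
    ... | inj₂ (inj₁ refl)        = Fin.suc Fin.zero , refl
    ... | inj₂ (inj₂ (inj₁ refl)) = Fin.suc (Fin.suc Fin.zero) , refl
    ... | inj₂ (inj₂ (inj₂ refl)) = Fin.suc (Fin.suc (Fin.suc Fin.zero)) , refl

  SmallShape : Subset n → Set
  SmallShape T = SpanningCycle T 3 ⊎ SpanningCycle T 4

  module _ {T : Subset n} where
    open SpanningCycle

    smallShape-card : SmallShape T → ∣ T ∣ ≡ 3 ⊎ ∣ T ∣ ≡ 4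
    smallShape-card (inj₁ Z) = inj₁ (spanning-card {M = G} (cycle Z) (onto Z))
    smallShape-card (inj₂ Z) = inj₂ (spanning-card {M = G} (cycle Z) (onto Z))

    smallShape-card≤4 : SmallShape T → ∣ T ∣ ≤ 4
    smallShape-card≤4 shape =
      [ (λ eq → ≤-trans (≤-reflexive eq) (n≤1+n 3)) , ≤-reflexive ]′ (smallShape-card shape)

    smallShape-TwoNC : SmallShape T → TwoNC (induced G T)
    smallShape-TwoNC (inj₁ Z) = spanning-TwoNC {M = G} (cycle Z) (onto Z) (inj₁ refl)
    smallShape-TwoNC (inj₂ Z) = spanning-TwoNC {M = G} (cycle Z) (onto Z) (inj₂ refl)

    smallShape-cycle : SmallShape T → Σ (Cycle (induced G T) ∣ T ∣) λ Z → cycleCost cost Z ≡ 2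
    smallShape-cycle (inj₁ Z) rewrite spanning-card {M = G} (cycle Z) (onto Z) = cycle Z , cost≡2 Z
    smallShape-cycle (inj₂ Z) rewrite spanning-card {M = G} (cycle Z) (onto Z) = cycle Z , cost≡2 Z

  SubgraphOf⇒Reach : ∀ {K M} → SubgraphOf I K M → Reach K u v → Reach M u v
  SubgraphOf⇒Reach (V⊆ , _   , _    , _) (here u∈)      = here (V⊆ u∈)
  SubgraphOf⇒Reach {K = K} {M} sub@(_ , E⊆ , end≡ , _) (step {x = u} {y = v} e e∈ j r) =
    step e (E⊆ e∈) (subst (λ en → en e ≡ (u , v) ⊎ en e ≡ (v , u)) end≡ j) (SubgraphOf⇒Reach sub r)

  ZeroFreeCut : Subset n → Set
  ZeroFreeCut T = ∀ e → (proj₁ (ends e) ∈ T × proj₂ (ends e) ∉ T) ⊎ (proj₁ (ends e) ∉ T × proj₂ (ends e) ∈ T)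
                      → cost e ≢ 0

  module Contraction (S : Subset n) {r : Fin n} (r∈S : r ∈ S) where

    M : Gr n m
    M = contract G S r

    M⁻ : Gr n m
    M⁻ = delNodes M ⁅ r ⁆

    private
      squash : Fin n → Fin n
      squash x = if lookup S x then r else x

      squash-∉ : u ∉ S → squash u ≡ u
      squash-∉ {u} u∉ with lookup S u | ∉⇒T-not u∉
      ... | false | _ = refl

      squash-∈ : u ∈ S → squash u ≡ r
      squash-∈ {u} u∈ with lookup S u | ∈⇒T u∈
      ... | true | _ = refl

      squash≡r⇒∈ : squash u ≡ r → u ∈ S
      squash≡r⇒∈ {u} eq with lookup S u in lk
      ... | true  = T⇒∈ (subst T (sym lk) _)
      ... | false = subst (_∈ S) (sym eq) r∈S

      ∉⇒≢r : u ∉ S → u ≢ r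
      ∉⇒≢r u∉ refl = u∉ r∈S

    ∈V-M⁻⁺ : u ∉ S → u ∈ V M⁻
    ∈V-M⁻⁺ {u} u∉ =
      ∈V-delNodes⁺ {M = M} (T⇒∈-tabulate (T-∨⁺ˡ (u =ᵇ r) (T-∧⁺ (∈⇒T (∈⊤ {x = u})) (∉⇒T-not u∉))))
                           (x≢y⇒x∉⁅y⁆ (∉⇒≢r u∉))

    ∈V-M⁻⁻ : u ∈ V M⁻ → u ∉ S
    ∈V-M⁻⁻ u∈ u∈S with ∈V-delNodes⁻ {M = M} u∈
    ... | u∈M , u∉r with Equivalence.to T-∨ (∈-tabulate⇒T u∈M)
    ...   | inj₁ t = T-not⇒∉ (proj₂ (T-∧⁻ t)) u∈S
    ...   | inj₂ t = u∉r (subst (_∈ ⁅ r ⁆) (sym (T-=ᵇ t)) (x∈⁅x⁆ r))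

    ∈E-M⇒¬both∈S : e ∈ E M → ¬ (proj₁ (ends e) ∈ S × proj₂ (ends e) ∈ S)
    ∈E-M⇒¬both∈S e∈ (∈₁ , ∈₂) = T-not⇒¬T (proj₂ (T-∧⁻ (∈-tabulate⇒T e∈))) (T-∧⁺ (∈⇒T ∈₁) (∈⇒T ∈₂))

    private
      end-M≡ends : proj₁ (ends e) ∉ S → proj₂ (ends e) ∉ S → end M e ≡ ends e
      end-M≡ends ∉₁ ∉₂ = cong₂ _,_ (squash-∉ ∉₁) (squash-∉ ∉₂)

    M⁻-edge⁻ : e ∈ E M⁻ → Joins M⁻ e u v → Joins G e u v × u ∉ S × v ∉ S
    M⁻-edge⁻ {e} e∈ j with ∈E-delNodes⁻ {M = M} e∈
    ... | _ , ∉r₁ , ∉r₂ =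
      let ∉₁ = λ ∈₁ → ∉r₁ (subst (_∈ ⁅ r ⁆) (sym (squash-∈ ∈₁)) (x∈⁅x⁆ r))
          ∉₂ = λ ∈₂ → ∉r₂ (subst (_∈ ⁅ r ⁆) (sym (squash-∈ ∈₂)) (x∈⁅x⁆ r))
          jG = subst (λ en → en ≡ _ ⊎ en ≡ _) (end-M≡ends ∉₁ ∉₂) j
      in jG , Joins-both⁻ {M = G} (_∉ S) jG ∉₁ ∉₂

    M⁻-edge⁺ : Joins G e u v → u ∉ S → v ∉ S → e ∈ E M⁻ × Joins M⁻ e u v
    M⁻-edge⁺ {e} j u∉ v∉ =
      let ∉₁ , ∉₂ = Joins-both⁺ {M = G} (_∉ S) j u∉ v∉
          e∈M : e ∈ E M
          e∈M = T⇒∈-tabulate (T-∧⁺ (∈⇒T (∈⊤ {x = e})) (not-both∈S ∉₁))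
          ∉r : ∀ {x} → x ∉ S → squash x ∉ ⁅ r ⁆
          ∉r x∉ = x≢y⇒x∉⁅y⁆ (∉⇒≢r (subst (_∉ S) (sym (squash-∉ x∉)) x∉))
      in ∈E-delNodes⁺ {M = M} e∈M (∉r ∉₁) (∉r ∉₂)
         , subst (λ en → en ≡ _ ⊎ en ≡ _) (sym (end-M≡ends ∉₁ ∉₂)) j
      where
      not-both∈S : proj₁ (ends e) ∉ S → T (not (lookup S (proj₁ (ends e)) ∧ lookup S (proj₂ (ends e))))
      not-both∈S ∉₁ with lookup S (proj₁ (ends e)) | ∉⇒T-not ∉₁
      ... | false | _ = _

    Joins-M-outside : Joins M e u v → u ∉ S → IsEnd G u e
    Joins-M-outside {e} j u∉ with Joins⇒IsEnd {M = M} j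
    ... | inj₁ eq with proj₁ (ends e) ∈? S
    ...   | yes ∈₁ = contradiction (subst (_∈ S) (trans (sym (squash-∈ ∈₁)) eq) r∈S) u∉
    ...   | no  ∉₁ = inj₁ (trans (sym (squash-∉ ∉₁)) eq)
    Joins-M-outside {e} j u∉ | inj₂ eq with proj₂ (ends e) ∈? S
    ...   | yes ∈₂ = contradiction (subst (_∈ S) (trans (sym (squash-∈ ∈₂)) eq) r∈S) u∉
    ...   | no  ∉₂ = inj₂ (trans (sym (squash-∉ ∉₂)) eq)

    unit-at-r : ZeroFreeCut S → e ∈ E M → Joins M e r v → cost e ≡ 1
    unit-at-r {e} zero-free e∈ j with costBin e
    ... | inj₂ c = c
    ... | inj₁ c with Joins⇒IsEnd {M = M} j
    ...   | inj₁ eq = let ∈₁ = squash≡r⇒∈ eq in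
                      contradiction c (zero-free e (inj₁ (∈₁ , λ ∈₂ → ∈E-M⇒¬both∈S e∈ (∈₁ , ∈₂))))
    ...   | inj₂ eq = let ∈₂ = squash≡r⇒∈ eq in
                      contradiction c (zero-free e (inj₂ ((λ ∈₁ → ∈E-M⇒¬both∈S e∈ (∈₁ , ∈₂)) , ∈₂)))

    -- The two F′-edges at r are unit edges, and a node z of D that is not at their other ends has
    -- a unit F′-edge of its own, since zero-edges form a matching.
    wBlock-opt≥3 : ZeroFreeCut S → ∀ {D x₀ x₁ x₂} → (∀ {d} → d ∈ D → d ∉ S) →
                   x₀ ∈ D → x₁ ∈ D → x₂ ∈ D → x₀ ≢ x₁ → x₀ ≢ x₂ → x₁ ≢ x₂ →
                   OptAtLeast cost (wBlock M r D) 3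
    wBlock-opt≥3 zero-free {D} D∌ x₀∈ x₁∈ x₂∈ ≢₀₁ ≢₀₂ ≢₁₂ F′ F′⊆ twoEC =
      let b , y , b∈ , c_b , j_b = unit-at-z (TwoEC⇒TwoEdgesAt twoEC (∈W z∈) r∈W (≢r z∈))
      in three≤sumSel cost edge₁≢edge₂
           (not-through {M = M} joins₁ j_b (≢r z∈) z≢nbr₁ ∘ sym)
           (not-through {M = M} joins₂ j_b (≢r z∈) z≢nbr₂ ∘ sym)
           edge₁∈ edge₂∈ b∈ (unit-at-r zero-free (in-M edge₁∈) joins₁)
           (unit-at-r zero-free (in-M edge₂∈) joins₂) c_b
      where
      W = wBlock M r D

      r∈W : r ∈ V W
      r∈W = x∈p∪q⁺ (inj₁ (x∈⁅x⁆ r))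

      ∈W : ∀ {d} → d ∈ D → d ∈ V W
      ∈W d∈ = x∈p∪q⁺ (inj₂ d∈)

      ≢r : ∀ {d} → d ∈ D → d ≢ r
      ≢r d∈ = ∉⇒≢r (D∌ d∈)

      in-M : ∀ {e} → e ∈ F′ → e ∈ E M
      in-M e∈ = proj₁ (∈E-induced⁻ {M = M} {S = ⁅ r ⁆ ∪ D} (F′⊆ e∈))

      open TwoEdgesAt (TwoEC⇒TwoEdgesAt twoEC r∈W (∈W x₀∈) (≢r x₀∈ ∘ sym))

      z-avoiding = avoid-two (_∈ D) {y₁ = nbr₁} {y₂ = nbr₂} ≢₀₁ ≢₀₂ ≢₁₂ x₀∈ x₁∈ x₂∈
      z = proj₁ z-avoiding
      z∈ = proj₁ (proj₂ z-avoiding)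
      z≢nbr₁ = proj₁ (proj₂ (proj₂ z-avoiding))
      z≢nbr₂ = proj₂ (proj₂ (proj₂ z-avoiding))

      unit-at-z : TwoEdgesAt (withEdges W F′) z → ∃[ b ] ∃[ y ] (b ∈ F′ × cost b ≡ 1 × Joins M b z y)
      unit-at-z two with costBin (TwoEdgesAt.edge₁ two) | costBin (TwoEdgesAt.edge₂ two)
      ... | inj₂ c | _ = _ , _ , TwoEdgesAt.edge₁∈ two , c , TwoEdgesAt.joins₁ two
      ... | inj₁ _ | inj₂ c = _ , _ , TwoEdgesAt.edge₂∈ two , c , TwoEdgesAt.joins₂ two
      ... | inj₁ c₁ | inj₁ c₂ = ⊥-elim (matching _ _ c₁ c₂ (TwoEdgesAt.edge₁≢edge₂ two) z
              (Joins-M-outside (TwoEdgesAt.joins₁ two) (D∌ z∈)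
              , Joins-M-outside (TwoEdgesAt.joins₂ two) (D∌ z∈)))

  module Spanning (F : Subset m) (goodH : GoodH I F) where

    H : Gr n m
    H = withEdges G F

    private
      zero∈F = proj₁ goodH
      H-simple = proj₁ (proj₂ goodH)
      H-bridgeless = proj₁ (proj₂ (proj₂ goodH))
      H-deg≥2 = proj₂ (proj₂ (proj₂ goodH))

    no-parallel : e ∈ F → f ∈ F → e ≢ f → Joins G e u v → Joins G f u v → ⊥
    no-parallel {e = e} {f} {u} {v} e∈ f∈ e≢f jₑ j_f = H-simple (e , f , e∈ , f∈ , e≢f , parallel jₑ)
      where
      parallel : Joins G e u v → Joins G f (proj₁ (ends e)) (proj₂ (ends e))
      parallel (inj₁ eq) rewrite eq = j_f
      parallel (inj₂ eq) rewrite eq = Joins-sym {M = G} j_f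

    twoEdges : ∀ u → TwoEdgesAt H u
    twoEdges u = deg≥2⇒TwoEdgesAt (H-deg≥2 u)

    twoEdges-nbr₁≢nbr₂ : ∀ u → TwoEdgesAt.nbr₁ (twoEdges u) ≢ TwoEdgesAt.nbr₂ (twoEdges u)
    twoEdges-nbr₁≢nbr₂ u eq =
      no-parallel edge₁∈ edge₂∈ edge₁≢edge₂ joins₁ (subst (Joins G edge₂ u) (sym eq) joins₂)
      where open TwoEdgesAt (twoEdges u)

    -- The 2ec-blocks of H are its connected components, because H is bridgeless.

    Block : Gr n m → Set
    Block = TwoECBlock I H

    private
      C : Fin n → Subset n
      C = component H

    componentBlock : Fin n → Gr n m
    componentBlock u = induced H (C u)

    component-closed : v ∈ C u → e ∈ F → Joins G e v w → w ∈ C u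
    component-closed {w = w} v∈ e∈ j = ∈-component⁺ (Reach-trans (∈-component⁻ v∈) (step _ e∈ j (here ∈⊤)))

    edge-in-componentBlock : v ∈ C u → e ∈ F → Joins G e v w → w ∈ C u × e ∈ E (componentBlock u)
    edge-in-componentBlock {u = u} v∈ e∈ j =
      let w∈ = component-closed v∈ e∈ j
          ends∈ = Joins-both⁺ {M = G} (_∈ C u) j v∈ w∈
      in w∈ , ∈E-induced⁺ {M = H} e∈ (proj₁ ends∈) (proj₂ ends∈)

    Reach-componentBlock : Reach H v w → v ∈ C u → Reach (componentBlock u) v w
    Reach-componentBlock {u = u} =
      Reach-transfer (_∈ C u) (λ _ v∈ → v∈)
        (λ e∈ j v∈ → let w∈ , e∈′ = edge-in-componentBlock v∈ e∈ j in w∈ , e∈′ , j)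

    componentBlock-subgraph : SubgraphOf I (componentBlock u) H
    componentBlock-subgraph {u = u} = (λ _ → ∈⊤) , (λ e∈ → proj₁ (∈E-induced⁻ {M = H} {S = C u} e∈)) , refl
                                    , induced-EndsInside {M = H} {S = C u}

    componentBlock-blockLike : ∀ u → BlockLike I (componentBlock u)
    componentBlock-blockLike u = connected , two-nodes , bridgeless
      where
      u∈ : u ∈ C u
      u∈ = ∈-component⁺ (here ∈⊤)

      connected : Connected (componentBlock u)
      connected x y x∈ y∈ =
        Reach-trans (Reach-sym (induced-EndsInside {M = H} {S = C u})
                               (Reach-componentBlock (∈-component⁻ x∈) u∈))
                    (Reach-componentBlock (∈-component⁻ y∈) u∈)

      two-nodes : ∣ C u ∣ ≥ 2
      two-nodes = length≤∣p∣ ((Joins⇒≢ joins₁ ∷ []) ∷ [] ∷ [])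
                             (u∈ ∷ component-closed u∈ edge₁∈ joins₁ ∷ [])
        where open TwoEdgesAt (twoEdges u)

      bridgeless : ∀ g → ¬ Bridge (componentBlock u) g
      bridgeless g (g∈ , ¬reach) with ∈E-induced⁻ {M = H} g∈
      ... | g∈F , end₁∈ , _ =
        H-bridgeless g (g∈F , ¬reach ∘ λ r → Reach-transfer (_∈ C u) (λ _ v∈ → v∈) edge-inside r end₁∈)
        where
        edge-inside : ∀ {e v w} → e ∈ E (delEdge H g) → Joins G e v w → v ∈ C u →
               w ∈ C u × e ∈ E (delEdge (componentBlock u) g) × Joins G e v w
        edge-inside e∈ j v∈ with ∈E-delEdge⁻ {M = H} e∈
        ... | e∈F , e≢g = let w∈ , e∈′ = edge-in-componentBlock v∈ e∈F j
                          in w∈ , ∈E-delEdge⁺ {M = componentBlock u} e∈′ e≢g , j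

    block≡componentBlock : ∀ {K} → Block K → u ∈ V K → componentBlock u ≡ K
    block≡componentBlock {u = u} {K} (sub@(_ , E⊆F , end≡ , inside) , blockLike , maximal) u∈ =
      maximal (componentBlock u) componentBlock-subgraph (componentBlock-blockLike u) V⊆ E⊆
      where
      V⊆ : V K ⊆ C u
      V⊆ x∈ = ∈-component⁺ (SubgraphOf⇒Reach sub (proj₁ blockLike _ _ u∈ x∈))
      E⊆ : E K ⊆ E (componentBlock u)
      E⊆ {e} e∈ = ∈E-induced⁺ {M = H} (E⊆F e∈)
        (V⊆ (subst (λ en → proj₁ (en e) ∈ V K) end≡ (proj₁ (inside e e∈))))
        (V⊆ (subst (λ en → proj₂ (en e) ∈ V K) end≡ (proj₂ (inside e e∈))))

    block-closed : ∀ {K} → Block K → e ∈ F → Joins G e u v → u ∈ V K → v ∈ V K × e ∈ E K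
    block-closed {u = u} block e∈ j u∈ =
      subst (λ K → _ ∈ V K × _ ∈ E K) (block≡componentBlock block u∈)
            (edge-in-componentBlock (∈-component⁺ (here ∈⊤)) e∈ j)

    block-unique : ∀ {K K′} → Block K → Block K′ → u ∈ V K → u ∈ V K′ → K ≡ K′
    block-unique block block′ u∈ u∈′ =
      trans (sym (block≡componentBlock block u∈)) (block≡componentBlock block′ u∈′)

    -- Small 2ec-blocks: every node lies on a unit edge of the block and there are at most two of
    -- them; a case analysis from one node then closes a triangle or a 4-cycle of cost two.

    module SmallBlock {K} (block : Block K) (small : Small I K) where

      private
        closed : e ∈ F → Joins G e u v → u ∈ V K → v ∈ V K × e ∈ E K
        closed = block-closed block

        isUnit : Fin m → ℕ
        isUnit e = if ⌊ cost e ℕ.≟ 1 ⌋ then 1 else 0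

        isUnit≡1 : cost e ≡ 1 → isUnit e ≡ 1
        isUnit≡1 c rewrite c = refl

      unit-at : u ∈ V K → ∃[ e ] ∃[ v ] (e ∈ E K × cost e ≡ 1 × Joins G e u v)
      unit-at {u} u∈ = pick (costBin edge₁) (costBin edge₂)
        where
        open TwoEdgesAt (twoEdges u)
        pick : cost edge₁ ≡ 0 ⊎ cost edge₁ ≡ 1 → cost edge₂ ≡ 0 ⊎ cost edge₂ ≡ 1 →
               ∃[ e ] ∃[ v ] (e ∈ E K × cost e ≡ 1 × Joins G e u v)
        pick (inj₂ c)  _        = edge₁ , nbr₁ , proj₂ (closed edge₁∈ joins₁ u∈) , c , joins₁
        pick (inj₁ _)  (inj₂ c) = edge₂ , nbr₂ , proj₂ (closed edge₂∈ joins₂ u∈) , c , joins₂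
        pick (inj₁ c₁) (inj₁ c₂) = ⊥-elim (zero-edges-disjoint c₁ c₂ edge₁≢edge₂ joins₁ joins₂)

      only-two-units : e ∈ E K → f ∈ E K → e ≢ f → cost e ≡ 1 → cost f ≡ 1 →
                       ∀ {g} → g ∈ E K → cost g ≡ 1 → g ≡ e ⊎ g ≡ f
      only-two-units e∈ f∈ e≢f cₑ c_f {g} g∈ c_g with g Fin.≟ _ | g Fin.≟ _
      ... | yes g≡e | _       = inj₁ g≡e
      ... | no  _   | yes g≡f = inj₂ g≡f
      ... | no  g≢e | no  g≢f = ⊥-elim (1+n≰n (≤-trans
            (three≤sumSel isUnit e≢f (g≢e ∘ sym) (g≢f ∘ sym) e∈ f∈ g∈
                          (isUnit≡1 cₑ) (isUnit≡1 c_f) (isUnit≡1 c_g))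
            small))

      covered-by-units : e ∈ E K → f ∈ E K → e ≢ f → cost e ≡ 1 → cost f ≡ 1 →
                         Joins G e u v → Joins G f u′ v′ →
                         ∀ {w} → w ∈ V K → (w ≡ u ⊎ w ≡ v) ⊎ (w ≡ u′ ⊎ w ≡ v′)
      covered-by-units e∈ f∈ e≢f cₑ c_f jₑ j_f w∈ with unit-at w∈
      ... | g , _ , g∈ , c_g , j_g with only-two-units e∈ f∈ e≢f cₑ c_f g∈ c_g
      ...   | inj₁ refl = inj₁ (Joins-ends {M = G} jₑ j_g)
      ...   | inj₂ refl = inj₂ (Joins-ends {M = G} j_f j_g)

      Shape : Set
      Shape = SmallShape (V K)

      two-units-at : ∀ {t p q e₁ e₂} → t ∈ V K → e₁ ∈ F → e₂ ∈ F → e₁ ≢ e₂ → cost e₁ ≡ 1 → cost e₂ ≡ 1 →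
                     Joins G e₁ t p → Joins G e₂ t q → p ≢ q → Shape
      two-units-at {t} {p} {q} {e₁} {e₂} t∈ e₁∈F e₂∈F e₁≢e₂ c₁ c₂ j₁ j₂ p≢q
        with closed e₁∈F j₁ t∈ | closed e₂∈F j₂ t∈ | otherEdge (twoEdges q) e₂
      ... | p∈ , e₁∈ | q∈ , e₂∈ | g , q′ , g∈F , g≢e₂ , j_g with closed g∈F j_g q∈ | costBin g
      ... | q′∈ , g∈ | inj₂ c_g with only-two-units e₁∈ e₂∈ e₁≢e₂ c₁ c₂ g∈ c_g
      ...   | inj₂ g≡e₂ = ⊥-elim (g≢e₂ g≡e₂)
      ...   | inj₁ refl = ⊥-elim ([ Joins⇒≢ j₂ ∘ sym , p≢q ∘ sym ]′ (Joins-ends {M = G} j₁ j_g))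
      two-units-at {t} {p} {q} {e₁} {e₂} t∈ e₁∈F e₂∈F e₁≢e₂ c₁ c₂ j₁ j₂ p≢q
          | p∈ , e₁∈ | q∈ , e₂∈ | g , q′ , g∈F , g≢e₂ , j_g | q′∈ , g∈ | inj₁ c_g
        with covered-by-units e₁∈ e₂∈ e₁≢e₂ c₁ c₂ j₁ j₂ q′∈
      ... | inj₁ (inj₁ refl) = ⊥-elim (no-parallel g∈F e₂∈F g≢e₂ j_g (Joins-sym {M = G} j₂))
      ... | inj₂ (inj₁ refl) = ⊥-elim (no-parallel g∈F e₂∈F g≢e₂ j_g (Joins-sym {M = G} j₂))
      ... | inj₂ (inj₂ refl) = ⊥-elim (Joins⇒≢ j_g refl)
      ... | inj₁ (inj₂ refl) =
        inj₁ (triangle (Joins⇒≢ j₁) (Joins⇒≢ j₂) p≢q j₁ (Joins-sym {M = G} j_g) (Joins-sym {M = G} j₂)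
                       (cong₂ _+_ c₁ (cong₂ _+_ c_g (cong (_+ 0) c₂))) t∈ p∈ q∈
                       ([ [ inj₁ , inj₂ ∘ inj₁ ]′ , [ inj₁ , inj₂ ∘ inj₂ ]′ ]′
                          ∘ covered-by-units e₁∈ e₂∈ e₁≢e₂ c₁ c₂ j₁ j₂))

      unit-and-zero-at : ∀ {t p q eu ez} → t ∈ V K → eu ∈ F → ez ∈ F → cost eu ≡ 1 → cost ez ≡ 0 →
                         Joins G eu t p → Joins G ez t q → p ≢ q → Shape
      unit-and-zero-at {t} {p} {q} {eu} {ez} t∈ eu∈F ez∈F cu cz ju jz p≢q
        with closed eu∈F ju t∈ | closed ez∈F jz t∈ | otherEdge (twoEdges q) ez
      ... | p∈ , eu∈ | q∈ , ez∈ | g , q′ , g∈F , g≢ez , j_g with closed g∈F j_g q∈ | costBin g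
      ... | _ | inj₁ c_g = ⊥-elim (zero-edges-disjoint c_g cz g≢ez j_g (Joins-sym {M = G} jz))
      ... | q′∈ , g∈ | inj₂ c_g with g Fin.≟ eu
      ...   | yes refl = ⊥-elim ([ Joins⇒≢ jz ∘ sym , p≢q ∘ sym ]′ (Joins-ends {M = G} ju j_g))
      ...   | no g≢eu with q′ Fin.≟ p
      ...     | yes refl =
        inj₁ (triangle (Joins⇒≢ ju) (Joins⇒≢ jz) p≢q ju (Joins-sym {M = G} j_g) (Joins-sym {M = G} jz)
                       (cong₂ _+_ cu (cong₂ _+_ c_g (cong (_+ 0) cz))) t∈ p∈ q∈
                       ([ [ inj₁ , inj₂ ∘ inj₁ ]′ , [ inj₂ ∘ inj₂ , inj₂ ∘ inj₁ ]′ ]′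
                          ∘ covered-by-units eu∈ g∈ (g≢eu ∘ sym) cu c_g ju j_g))
      ...     | no q′≢p with otherEdge (twoEdges p) eu
      ...       | h , p′ , h∈F , h≢eu , j_h with closed h∈F j_h p∈ | costBin h
      ...         | _ , h∈ | inj₂ c_h with only-two-units eu∈ g∈ (g≢eu ∘ sym) cu c_g h∈ c_h
      ...           | inj₁ h≡eu = ⊥-elim (h≢eu h≡eu)
      ...           | inj₂ refl = ⊥-elim ([ p≢q , q′≢p ∘ sym ]′ (Joins-ends {M = G} j_g j_h))
      unit-and-zero-at {t} {p} {q} {eu} {ez} t∈ eu∈F ez∈F cu cz ju jz p≢q
          | p∈ , eu∈ | q∈ , ez∈ | g , q′ , g∈F , g≢ez , j_g | q′∈ , g∈ | inj₂ c_g | no g≢eu | no q′≢p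
          | h , p′ , h∈F , h≢eu , j_h | p′∈ , h∈ | inj₁ c_h
        with covered-by-units eu∈ g∈ (g≢eu ∘ sym) cu c_g ju j_g p′∈
      ... | inj₁ (inj₁ refl) = ⊥-elim (zero-edges-disjoint c_h cz h≢ez (Joins-sym {M = G} j_h) jz)
        where h≢ez = not-through {M = G} jz j_h (Joins⇒≢ ju ∘ sym) p≢q
      ... | inj₁ (inj₂ refl) = ⊥-elim (Joins⇒≢ j_h refl)
      ... | inj₂ (inj₁ refl) =
        ⊥-elim (zero-edges-disjoint c_h cz h≢ez (Joins-sym {M = G} j_h) (Joins-sym {M = G} jz))
        where h≢ez = not-through {M = G} jz j_h (Joins⇒≢ ju ∘ sym) p≢q
      ... | inj₂ (inj₂ refl) =
        inj₂ (square (Joins⇒≢ ju) t≢q′ (Joins⇒≢ jz) (q′≢p ∘ sym) p≢q (Joins⇒≢ j_g ∘ sym)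
                     ju j_h (Joins-sym {M = G} j_g) (Joins-sym {M = G} jz)
                     (cong₂ _+_ cu (cong₂ _+_ c_h (cong₂ _+_ c_g (cong (_+ 0) cz)))) t∈ p∈ p′∈ q∈
                     ([ [ inj₁ , inj₂ ∘ inj₁ ]′ , [ inj₂ ∘ inj₂ ∘ inj₂ , inj₂ ∘ inj₂ ∘ inj₁ ]′ ]′
                        ∘ covered-by-units eu∈ g∈ (g≢eu ∘ sym) cu c_g ju j_g))
        where
        t≢q′ : t ≢ q′
        t≢q′ refl = no-parallel g∈F ez∈F g≢ez j_g (Joins-sym {M = G} jz)

      shape : Shape
      shape with ∣p∣≥1⇒∃∈ (≤-trans (s≤s z≤n) (proj₁ (proj₂ (proj₁ (proj₂ block)))))
      ... | t , t∈ = by-costs (costBin edge₁) (costBin edge₂)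
        where
        open TwoEdgesAt (twoEdges t)
        p≢q = twoEdges-nbr₁≢nbr₂ t
        by-costs : cost edge₁ ≡ 0 ⊎ cost edge₁ ≡ 1 → cost edge₂ ≡ 0 ⊎ cost edge₂ ≡ 1 → Shape
        by-costs (inj₂ c₁) (inj₂ c₂) = two-units-at t∈ edge₁∈ edge₂∈ edge₁≢edge₂ c₁ c₂ joins₁ joins₂ p≢q
        by-costs (inj₂ c₁) (inj₁ c₂) = unit-and-zero-at t∈ edge₁∈ edge₂∈ c₁ c₂ joins₁ joins₂ p≢q
        by-costs (inj₁ c₁) (inj₂ c₂) = unit-and-zero-at t∈ edge₂∈ edge₁∈ c₂ c₁ joins₂ joins₁ (p≢q ∘ sym)
        by-costs (inj₁ c₁) (inj₁ c₂) = ⊥-elim (zero-edges-disjoint c₁ c₂ edge₁≢edge₂ joins₁ joins₂)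


    block-zero-free-cut : ∀ {K} → Block K → ZeroFreeCut (V K)
    block-zero-free-cut block e (inj₁ (∈₁ , ∉₂)) c =
      ∉₂ (proj₁ (block-closed block (zero∈F e c) (inj₁ refl) ∈₁))
    block-zero-free-cut block e (inj₂ (∉₁ , ∈₂)) c =
      ∉₁ (proj₁ (block-closed block (zero∈F e c) (inj₂ refl) ∈₂))

    module _ {B} (blockB : Block B) {r} (r∈B : r ∈ V B) where
      open Contraction (V B) r∈B

      outside-component : u ∉ V B → Component M⁻ (component M⁻ u)
      outside-component u∉ = _ , ∈V-M⁻⁺ u∉ , λ v →
        (λ v∈ → Reach-target (∈-component⁻ v∈) , ∈-component⁻ v∈) , (∈-component⁺ ∘ proj₂)

      outside-wBlock-opt≥3 : u ∉ V B → OptAtLeast cost (wBlock M r (component M⁻ u)) 3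
      outside-wBlock-opt≥3 {u} u∉ =
        wBlock-opt≥3 (block-zero-free-cut blockB) (λ d∈ → ∈V-M⁻⁻ (Reach-target (∈-component⁻ d∈)))
          (∈-component⁺ (here (∈V-M⁻⁺ u∉))) (nbr∈ edge₁∈ joins₁) (nbr∈ edge₂∈ joins₂)
          (Joins⇒≢ joins₁) (Joins⇒≢ joins₂) (twoEdges-nbr₁≢nbr₂ u)
        where
        open TwoEdgesAt (twoEdges u)
        nbr∈ : e ∈ F → Joins G e u v → v ∈ component M⁻ u
        nbr∈ {v = v} e∈ j =
          let v∉ = λ v∈ → u∉ (proj₁ (block-closed blockB e∈ (Joins-sym {M = G} j) v∈))
              e∈′ , j′ = M⁻-edge⁺ j u∉ v∉
          in ∈-component⁺ (step _ e∈′ j′ (here (∈V-M⁻⁺ v∉)))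

    module Separated {A B} (blockA : Block A) (blockB : Block B) (B≢A : B ≢ A)
                     (Γ⊆B : ∀ y → Γ I (V A) y → y ∈ V B) where

      private
        leaves-A-into-B : u ∈ V A → Joins G e u v → v ∉ V B → v ∈ V A
        leaves-A-into-B {u} {e} {v} u∈ j v∉B with v ∈? V A
        ... | yes v∈A = v∈A
        ... | no  v∉A = contradiction (Γ⊆B v (v∉A , u , u∈ , e , ∈⊤ , j)) v∉B

        A∌B : u ∈ V A → u ∉ V B
        A∌B u∈A u∈B = B≢A (block-unique blockB blockA u∈B u∈A)

      separates : u ∈ V A → v ∉ V A → v ∉ V B → ¬ Connected (delNodes G (V B))
      separates {u} {v} u∈ v∉A v∉B connected =
        v∉A (Reach-preserves (_∈ V A) stays (connected u v (in-G-B (A∌B u∈)) (in-G-B v∉B)) u∈)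
        where
        in-G-B : ∀ {x} → x ∉ V B → x ∈ V (delNodes G (V B))
        in-G-B x∉ = ∈V-delNodes⁺ {M = G} ∈⊤ x∉
        stays : ∀ {e x y} → e ∈ E (delNodes G (V B)) → Joins G e x y → x ∈ V A → y ∈ V A
        stays e∈ j x∈ = let _ , ∉₁ , ∉₂ = ∈E-delNodes⁻ {M = G} e∈ in
                        leaves-A-into-B x∈ j (proj₂ (Joins-both⁻ {M = G} (_∉ V B) j ∉₁ ∉₂))

      two-wBlocks : ∀ {r} → r ∈ V B → u ∈ V A → v ∉ V A → v ∉ V B →
                    TwoWBlocks (contract G (V B) r) r (λ K → OptAtLeast cost K 3)
      two-wBlocks {u = u} {v = v} {r = r} r∈ u∈ v∉A v∉B =
        component M⁻ u , component M⁻ v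
        , outside-component blockB r∈ (A∌B u∈) , outside-component blockB r∈ v∉B
        , distinct
        , outside-wBlock-opt≥3 blockB r∈ (A∌B u∈) , outside-wBlock-opt≥3 blockB r∈ v∉B
        where
        open Contraction (V B) r∈
        distinct : component M⁻ u ≢ component M⁻ v
        distinct eq = v∉A (Reach-preserves (_∈ V A) stays
          (∈-component⁻ (subst (v ∈_) (sym eq) (∈-component⁺ (here (∈V-M⁻⁺ v∉B))))) u∈)
          where
          stays : ∀ {e x y} → e ∈ E M⁻ → Joins M⁻ e x y → x ∈ V A → y ∈ V A
          stays e∈ j x∈ = let jG , _ , y∉ = M⁻-edge⁻ e∈ j in leaves-A-into-B x∈ jG y∉

      small-block-is-S34 : n ≥ 12 → Small I A → Small I B → S34 I (V B)
      small-block-is-S34 n≥12 smallA smallB =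
          smallShape-TwoNC shapeB , smallShape-card shapeB , smallShape-cycle shapeB
        , separates a∈ z∉A z∉B , block-zero-free-cut blockB
        , r , r∈ , two-wBlocks r∈ a∈ z∉A z∉B
        where
        shapeA = SmallBlock.shape blockA smallA
        shapeB = SmallBlock.shape blockB smallB
        some-node : ∀ {K} → Block K → ∃[ x ] x ∈ V K
        some-node block = ∣p∣≥1⇒∃∈ (≤-trans (s≤s z≤n) (proj₁ (proj₂ (proj₁ (proj₂ block)))))
        a = proj₁ (some-node blockA)
        a∈ = proj₂ (some-node blockA)
        r = proj₁ (some-node blockB)
        r∈ = proj₂ (some-node blockB)
        outside = ∃∉∪ (V A) (V B) (≤-trans (s≤s (+-mono-≤ (smallShape-card≤4 shapeA) (smallShape-card≤4 shapeB)))
                                            (≤-trans (m≤m+n 9 3) n≥12))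
        z = proj₁ outside
        z∉A = proj₁ (proj₂ outside)
        z∉B = proj₂ (proj₂ outside)

lemma32 : ∀ {n m} (I : MAP n m) → WellStructured I →
    (F : Subset m) → GoodH I F →
    (A B : Gr n m) →
    TwoECBlock I (withEdges (Gof I) F) A → Small I A →
    TwoECBlock I (withEdges (Gof I) F) B → B ≢ A →
    (∀ y → Γ I (V A) y → y ∈ V B) →
    Large I B
lemma32 I (n≥12 , _ , _ , _ , _ , no-S34 , _) F goodH A B blockA smallA blockB B≢A Γ⊆B smallB =
  no-S34 (V B) (small-block-is-S34 n≥12 smallA smallB)
  where open Spanning I F goodH using (module Separated)
        open Separated blockA blockB B≢A Γ⊆B
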